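{- $$\sum_{n,m\ge 0}\binom{m}{2}a_2(m,n)q^n=\frac{1}{(q;q^2)_\infty}\left(\frac{q^5}{1-q^2}+\frac{q^6+q^8}{1-q^4}+\frac{q^8}{(1-q^2)(1-q^4)}+\frac{q^{11}+2q^{13}}{(1-q^4)(1-q^6)}+\frac{q^{16}}{(1-q^4)(1-q^8)}\right).$$
   Context: A partition of $n$ is a non-increasing finite sequence of positive integers summing to $n$ (the empty partition is the unique partition of $0$). Its Young diagram has $\lambda_i$ left-justified cells in row $i$; with $\lambda'_j$ the number of cells in column $j$, the hook length of cell $(i,j)$ is $h(i,j)=\lambda_i+\lambda'_j-i-j+1$. $a_2(m,n)$ is the number of partitions of $n$ into odd parts whose Young diagram has exactly $m$ cells of hook length $2$. Notation: $(a;q)_\infty=\prod_{k\ge 0}(1-aq^k)$; the identity is one of formal power series in $q$. -}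

module Defs where

open import Data.Nat using (ℕ; zero; suc; _+_; _*_; _∸_; _^_; _≤_; _<_; _≥_; _≤?_; _≟_; _%_)
open import Data.Nat.Divisibility using (_∣?_)
open import Data.Bool using (Bool; true; false; if_then_else_)
open import Data.List using (List; []; _∷_; length; filter; map; upTo)
open import Data.Nat.ListAction using (sum)
open import Data.List.Relation.Unary.All using (All)
open import Data.List.Relation.Unary.Linked using (Linked)
open import Relation.Binary.PropositionalEquality using (_≡_)
open import Relation.Nullary.Decidable using (⌊_⌋)
open import Data.Product using (_×_)

IsPartition : ℕ → List ℕ → Set
IsPartition n λs = Linked _≥_ λs × All (λ p → 0 < p) λs × sum λs ≡ n

IsOddPartition : ℕ → List ℕ → Set
IsOddPartition n λs = IsPartition n λs × All (λ p → p % 2 ≡ 1) λs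

-- λ_i (rows indexed from 1; 0 outside the diagram)
row : List ℕ → ℕ → ℕ
row []       _             = 0
row (p ∷ ps) zero          = 0
row (p ∷ ps) (suc zero)    = p
row (p ∷ ps) (suc (suc i)) = row ps (suc i)

col : List ℕ → ℕ → ℕ
col λs j = length (filter (λ p → j ≤? p) λs)

-- hook length h(i,j) = λ_i + λ'_j - i - j + 1  (positive for cells)
hook : List ℕ → ℕ → ℕ → ℕ
hook λs i j = (row λs i + col λs j + 1) ∸ (i + j)

cellsWithHook : ℕ → List ℕ → ℕ
cellsWithHook k λs =
  sum (map (λ i → length (filter (λ j → hook λs i j ≟ k)
                                 (map suc (upTo (row λs i)))))
           (map suc (upTo (length λs))))

FPS : Set
FPS = ℕ → ℕ

sumTo : ℕ → (ℕ → ℕ) → ℕ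
sumTo zero    f = f 0
sumTo (suc n) f = sumTo n f + f (suc n)

infixl 6 _⊕_
infixl 7 _⊗_

_⊕_ : FPS → FPS → FPS
(f ⊕ g) n = f n + g n

_⊗_ : FPS → FPS → FPS
(f ⊗ g) n = sumTo n (λ i → f i * g (n ∸ i))

mono : ℕ → FPS
mono a n = if ⌊ a ≟ n ⌋ then 1 else 0

one : FPS
one = mono 0

-- 1/(1 - q^k) = Σ_{j≥0} q^{jk}   (used only for k ≥ 1)
geom : ℕ → FPS
geom k n = if ⌊ k ∣? n ⌋ then 1 else 0

oddProd : ℕ → FPS
oddProd zero    = one
oddProd (suc N) = oddProd N ⊗ geom (2 * N + 1)

-- 1/(q;q^2)_∞ = Π_{t≥0} 1/(1 - q^{2t+1}), as a formal power series:
-- its q^n coefficient is that of the finite product over 2t+1 ≤ n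
-- (the remaining factors are ≡ 1 mod q^{n+1}).
invOddPoch : FPS
invOddPoch n = oddProd (suc n) n

rhs : FPS
rhs = invOddPoch ⊗
  ( mono 5 ⊗ geom 2
  ⊕ (mono 6 ⊕ mono 8) ⊗ geom 4
  ⊕ mono 8 ⊗ geom 2 ⊗ geom 4
  ⊕ (mono 11 ⊕ mono 13 ⊕ mono 13) ⊗ geom 4 ⊗ geom 6
  ⊕ mono 16 ⊗ geom 4 ⊗ geom 8 )

{-# OPTIONS --safe #-}
module Submission where

-- Sort odd partitions by their parts. Putting m parts equal to k = 2N + 1 on top of a
-- partition whose parts are at most k − 2 adds 0, b, b + 1, b + 1, … cells of hook length 2
-- (b = 1 if k ≥ 3, else 0), whatever lies below. So if P = ∏_{t<N} 1/(1 − q^(2t+1)) and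
-- S₀, S₁, S₂ are the generating functions of 1, h and binom(h, 2) (h = number of hook-2 cells)
-- over the odd partitions with parts below 2N + 1, then S₀ = P, S₁ = P·V_N and S₂ = P·W_N, where
-- V_N = Σ_{t<N} e_t and W_N = Σ_{s<t<N} e_s e_t + Σ_{t<N} c_t for explicit weights e_t, c_t.
-- The tails Σ_{t≥N} of these sums are sums of geometric series; in closed form they show that
-- W_N agrees with the bracket of the right-hand side below degree 2N + 1, and P agrees with
-- 1/(q;q²)_∞ below the same degree; the coefficient of q^n is read off at N = n + 1.

open import Defs
open import Algebra.Bundles using (CommutativeSemiring)
open import Algebra.Structures.Biased using (isCommutativeSemiringˡ)
import Algebra.Properties.CommutativeSemigroup as CommutativeSemigroupProperties
open import Data.Bool using (if_then_else_)
open import Data.List using (List; []; _∷_; _++_; [_]; length; filter; map; upTo; applyUpTo; replicate)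
open import Data.List.Membership.Propositional using (_∈_)
open import Data.List.Membership.Propositional.Properties using (∈-map⁺; ∈-map⁻; ∈-++⁺ˡ; ∈-++⁺ʳ; ∈-++⁻)
open import Data.List.Membership.Propositional.Properties.WithK using (unique∧set⇒bag)
open import Data.List.Properties
  using ( filter-accept; filter-reject; filter-none; filter-++; length-++; map-upTo; map-∘; map-cong
        ; map-cong-local; map-++; applyUpTo-∷ʳ; ++-cancelˡ)
open import Data.List.Relation.Binary.BagAndSetEquality using (∼bag⇒↭)
open import Data.List.Relation.Binary.Permutation.Propositional.Properties using () renaming (map⁺ to ↭-map⁺)
open import Data.List.Relation.Unary.All using (All; []; _∷_)
import Data.List.Relation.Unary.All as All
open import Data.List.Relation.Unary.All.Properties using (++⁺; ++⁻ʳ; replicate⁺; applyUpTo⁺₁)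
open import Data.List.Relation.Unary.AllPairs using ([]; _∷_)
open import Data.List.Relation.Unary.Any using (here)
open import Data.List.Relation.Unary.Linked using (Linked; []; [-]; _∷_)
import Data.List.Relation.Unary.Linked as Linked
open import Data.List.Relation.Unary.Unique.Propositional using (Unique)
import Data.List.Relation.Unary.Unique.Propositional.Properties as Unique
open import Data.Nat using (ℕ; zero; suc; _+_; _*_; _∸_; _≤_; _<_; _≥_; z≤n; s≤s; _≤?_; _≟_; _%_)
open import Data.Nat.Combinatorics using (_C_; nCk+nC[k+1]≡[n+1]C[k+1]; nC1≡n)
open import Data.Nat.Divisibility using (_∣_; _∣?_; divides; ∣m+n∣m⇒∣n; ∣m∣n⇒∣m+n; ∣-refl; ∣⇒≤)
open import Data.Nat.Induction using (<-rec)
open import Data.Nat.ListAction using (sum)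
open import Data.Nat.ListAction.Properties using (sum-++; sum-↭)
open import Data.Nat.Properties
open import Data.Product using (Σ; _×_; _,_; proj₁; proj₂)
open import Data.Sum using (inj₁; inj₂)
open import Function.Base using (_∘_)
open import Function.Bundles using (_⇔_; mk⇔)
open import Function.Construct.Composition using (_⇔-∘_)
open import Function.Construct.Symmetry using (⇔-sym)
open import Level using (0ℓ)
open import Relation.Binary.Bundles using (Setoid)
open import Relation.Binary.PropositionalEquality
  using (_≡_; _≢_; refl; sym; trans; cong; cong₂; subst; subst₂; module ≡-Reasoning)
import Relation.Binary.Reasoning.Setoid as SetoidReasoning
open import Relation.Binary.Structures using (IsEquivalence)
open import Relation.Nullary using (¬_; Dec; yes; no)
open import Relation.Nullary.Decidable using (isYes; isYes≗does; does; dec-true; dec-false; does-⇔)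
open import Relation.Nullary.Negation using (contradiction)

open CommutativeSemigroupProperties +-commutativeSemigroup using (interchange)

-- Formal power series

-- A record rather than a function type, so that both series can be recovered from a proof's
-- type by unification.
infix 4 _≈_
record _≈_ (f g : FPS) : Set where
  constructor coeffwise
  field coeff : ∀ n → f n ≡ g n
open _≈_

𝟘 : FPS
𝟘 _ = 0

infixr 8 _·_
_·_ : ℕ → FPS → FPS
(c · f) n = c * f n

shift : FPS → FPS
shift f n = f (suc n)

≈-isEquivalence : IsEquivalence _≈_
≈-isEquivalence = record
  { refl  = coeffwise λ _ → refl
  ; sym   = λ f≈g → coeffwise λ n → sym (coeff f≈g n)
  ; trans = λ f≈g g≈h → coeffwise λ n → trans (coeff f≈g n) (coeff g≈h n)
  }

series-setoid : Setoid 0ℓ 0ℓ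
series-setoid = record { isEquivalence = ≈-isEquivalence }

open Setoid series-setoid using () renaming (refl to ≈-refl; sym to ≈-sym; trans to ≈-trans)
module ≈-Reasoning = SetoidReasoning series-setoid

sumTo-cong : ∀ n {f g : ℕ → ℕ} → (∀ i → i ≤ n → f i ≡ g i) → sumTo n f ≡ sumTo n g
sumTo-cong zero    eq = eq 0 z≤n
sumTo-cong (suc n) eq =
  cong₂ _+_ (sumTo-cong n (λ i i≤n → eq i (m≤n⇒m≤1+n i≤n))) (eq (suc n) ≤-refl)

sumTo-zero : ∀ n {f} → (∀ i → i ≤ n → f i ≡ 0) → sumTo n f ≡ 0
sumTo-zero zero    eq = eq 0 z≤n
sumTo-zero (suc n) eq =
  cong₂ _+_ (sumTo-zero n (λ i i≤n → eq i (m≤n⇒m≤1+n i≤n))) (eq (suc n) ≤-refl)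

sumTo-suc : ∀ n f → sumTo (suc n) f ≡ f 0 + sumTo n (shift f)
sumTo-suc zero    f = refl
sumTo-suc (suc n) f =
  trans (cong (_+ f (suc (suc n))) (sumTo-suc n f)) (+-assoc (f 0) _ _)

sumTo-+ : ∀ n f g → sumTo n (λ i → f i + g i) ≡ sumTo n f + sumTo n g
sumTo-+ zero    f g = refl
sumTo-+ (suc n) f g =
  trans (cong (_+ (f (suc n) + g (suc n))) (sumTo-+ n f g))
        (interchange (sumTo n f) (sumTo n g) (f (suc n)) (g (suc n)))

sumTo-*ˡ : ∀ n c f → c * sumTo n f ≡ sumTo n (λ i → c * f i)
sumTo-*ˡ zero    c f = refl
sumTo-*ˡ (suc n) c f =
  trans (*-distribˡ-+ c (sumTo n f) _) (cong (_+ c * f (suc n)) (sumTo-*ˡ n c f))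

sumTo-reverse : ∀ n f → sumTo n f ≡ sumTo n (λ i → f (n ∸ i))
sumTo-reverse zero    f = refl
sumTo-reverse (suc n) f = begin
  sumTo n f + f (suc n)                  ≡⟨ +-comm (sumTo n f) _ ⟩
  f (suc n) + sumTo n f                  ≡⟨ cong (f (suc n) +_) (sumTo-reverse n f) ⟩
  f (suc n) + sumTo n (λ i → f (n ∸ i))  ≡⟨ sumTo-suc n (λ i → f (suc n ∸ i)) ⟨
  sumTo (suc n) (λ i → f (suc n ∸ i))    ∎
  where open ≡-Reasoning

⊗-suc : ∀ f g n → (f ⊗ g) (suc n) ≡ f 0 * g (suc n) + (shift f ⊗ g) n
⊗-suc f g n = sumTo-suc n _

⊗-cong : ∀ {f f′ g g′} → f ≈ f′ → g ≈ g′ → f ⊗ g ≈ f′ ⊗ g′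
⊗-cong f≈f′ g≈g′ = coeffwise λ n →
  sumTo-cong n (λ i _ → cong₂ _*_ (coeff f≈f′ i) (coeff g≈g′ (n ∸ i)))

⊕-cong : ∀ {f f′ g g′} → f ≈ f′ → g ≈ g′ → f ⊕ g ≈ f′ ⊕ g′
⊕-cong f≈f′ g≈g′ = coeffwise λ n → cong₂ _+_ (coeff f≈f′ n) (coeff g≈g′ n)

⊗-comm : ∀ f g → f ⊗ g ≈ g ⊗ f
⊗-comm f g = coeffwise λ n → begin
  sumTo n (λ i → f i * g (n ∸ i))                ≡⟨ sumTo-reverse n _ ⟩
  sumTo n (λ i → f (n ∸ i) * g (n ∸ (n ∸ i)))    ≡⟨ sumTo-cong n (swap n) ⟩
  sumTo n (λ i → g i * f (n ∸ i))                ∎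
  where
  open ≡-Reasoning
  swap : ∀ n i → i ≤ n → f (n ∸ i) * g (n ∸ (n ∸ i)) ≡ g i * f (n ∸ i)
  swap n i i≤n = trans (cong (λ j → f (n ∸ i) * g j) (m∸[m∸n]≡n i≤n)) (*-comm (f (n ∸ i)) (g i))

⊗-distribʳ : ∀ h f g → (f ⊕ g) ⊗ h ≈ f ⊗ h ⊕ g ⊗ h
⊗-distribʳ h f g = coeffwise λ n →
  trans (sumTo-cong n (λ i _ → *-distribʳ-+ (h (n ∸ i)) (f i) (g i))) (sumTo-+ n _ _)

·-⊗ : ∀ c f g → (c · f) ⊗ g ≈ c · (f ⊗ g)
·-⊗ c f g = coeffwise λ n → trans (sumTo-cong n (λ i _ → *-assoc c (f i) _)) (sym (sumTo-*ˡ n c _))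

shift-⊗ : ∀ f g → shift (f ⊗ g) ≈ f 0 · shift g ⊕ shift f ⊗ g
shift-⊗ f g = coeffwise (⊗-suc f g)

⊗-assoc : ∀ f g h → (f ⊗ g) ⊗ h ≈ f ⊗ (g ⊗ h)
⊗-assoc f g h = coeffwise (assoc-coeff f g h)
  where
  open ≡-Reasoning
  assoc-coeff : ∀ f g h n → ((f ⊗ g) ⊗ h) n ≡ (f ⊗ (g ⊗ h)) n
  assoc-coeff f g h zero    = *-assoc (f 0) (g 0) (h 0)
  assoc-coeff f g h (suc n) = begin
    ((f ⊗ g) ⊗ h) (suc n)
      ≡⟨ ⊗-suc (f ⊗ g) h n ⟩
    a + (shift (f ⊗ g) ⊗ h) n
      ≡⟨ cong (a +_) (coeff (≈-trans (⊗-cong (shift-⊗ f g) (≈-refl {h}))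
                                      (⊗-distribʳ h (f 0 · shift g) (shift f ⊗ g))) n) ⟩
    a + (((f 0 · shift g) ⊗ h) n + ((shift f ⊗ g) ⊗ h) n)
      ≡⟨ cong₂ (λ b c → a + (b + c)) (coeff (·-⊗ (f 0) (shift g) h) n) (assoc-coeff (shift f) g h n) ⟩
    a + (f 0 * (shift g ⊗ h) n + (shift f ⊗ (g ⊗ h)) n)
      ≡⟨ +-assoc a _ _ ⟨
    a + f 0 * (shift g ⊗ h) n + (shift f ⊗ (g ⊗ h)) n
      ≡⟨ cong (_+ (shift f ⊗ (g ⊗ h)) n) factor ⟩
    f 0 * (g 0 * h (suc n) + (shift g ⊗ h) n) + (shift f ⊗ (g ⊗ h)) n
      ≡⟨ cong (λ t → f 0 * t + (shift f ⊗ (g ⊗ h)) n) (⊗-suc g h n) ⟨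
    f 0 * (g ⊗ h) (suc n) + (shift f ⊗ (g ⊗ h)) n
      ≡⟨ ⊗-suc f (g ⊗ h) n ⟨
    (f ⊗ (g ⊗ h)) (suc n) ∎
    where
    a : ℕ
    a = f 0 * g 0 * h (suc n)
    factor : a + f 0 * (shift g ⊗ h) n ≡ f 0 * (g 0 * h (suc n) + (shift g ⊗ h) n)
    factor = trans (cong (_+ f 0 * (shift g ⊗ h) n) (*-assoc (f 0) (g 0) (h (suc n))))
                   (sym (*-distribˡ-+ (f 0) _ _))

⊗-zeroˡ : ∀ f → 𝟘 ⊗ f ≈ 𝟘
⊗-zeroˡ f = coeffwise λ n → sumTo-zero n (λ i _ → refl)

⊗-zeroʳ : ∀ f → f ⊗ 𝟘 ≈ 𝟘
⊗-zeroʳ f = ≈-trans (⊗-comm f 𝟘) (⊗-zeroˡ f)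

⊗-identityˡ : ∀ f → one ⊗ f ≈ f
⊗-identityˡ f = coeffwise identity-coeff
  where
  open ≡-Reasoning
  identity-coeff : ∀ n → (one ⊗ f) n ≡ f n
  identity-coeff zero    = +-identityʳ (f 0)
  identity-coeff (suc n) = begin
    (one ⊗ f) (suc n)          ≡⟨ ⊗-suc one f n ⟩
    f (suc n) + 0 + (𝟘 ⊗ f) n  ≡⟨ cong₂ _+_ (+-identityʳ (f (suc n))) (coeff (⊗-zeroˡ f) n) ⟩
    f (suc n) + 0              ≡⟨ +-identityʳ (f (suc n)) ⟩
    f (suc n)                  ∎

series-commutativeSemiring : CommutativeSemiring 0ℓ 0ℓ
series-commutativeSemiring = record
  { Carrier = FPS ; _≈_ = _≈_ ; _+_ = _⊕_ ; _*_ = _⊗_ ; 0# = 𝟘 ; 1# = one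
  ; isCommutativeSemiring = isCommutativeSemiringˡ record
    { +-isCommutativeMonoid = record
      { isMonoid = record
        { isSemigroup = record
          { isMagma = record { isEquivalence = ≈-isEquivalence ; ∙-cong = ⊕-cong }
          ; assoc   = λ f g h → coeffwise λ n → +-assoc (f n) (g n) (h n)
          }
        ; identity = (λ _ → ≈-refl) , (λ f → coeffwise λ n → +-identityʳ (f n))
        }
      ; comm = λ f g → coeffwise λ n → +-comm (f n) (g n)
      }
    ; *-isCommutativeMonoid = record
      { isMonoid = record
        { isSemigroup = record
          { isMagma = record { isEquivalence = ≈-isEquivalence ; ∙-cong = ⊗-cong }
          ; assoc   = ⊗-assoc
          }
        ; identity = ⊗-identityˡ , (λ f → ≈-trans (⊗-comm f one) (⊗-identityˡ f))
        }
      ; comm = ⊗-comm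
      }
    ; distribʳ = ⊗-distribʳ
    ; zeroˡ    = ⊗-zeroˡ
    }
  }

open import Algebra.Properties.CommutativeSemiring.Exp series-commutativeSemiring using (_^_; ^-distrib-*)
open import Algebra.Solver.Ring.NaturalCoefficients.Default series-commutativeSemiring
  using (solve; _:=_; _:+_; _:*_; _:^_; con)

mono-same : ∀ a → mono a a ≡ 1
mono-same a with a ≟ a
... | yes _   = refl
... | no a≢a = contradiction refl a≢a

mono-diff : ∀ {a n} → a ≢ n → mono a n ≡ 0
mono-diff {a} {n} a≢n with a ≟ n
... | yes a≡n = contradiction a≡n a≢n
... | no _    = refl

mono-suc : ∀ a n → mono (suc a) (suc n) ≡ mono a n
mono-suc a n = by-cases (a ≟ n)
  where
  by-cases : Dec (a ≡ n) → mono (suc a) (suc n) ≡ mono a n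
  by-cases (yes refl) = trans (mono-same (suc a)) (sym (mono-same a))
  by-cases (no a≢n)   = trans (mono-diff (a≢n ∘ suc-injective)) (sym (mono-diff a≢n))

mono-suc-⊗ : ∀ a f n → (mono (suc a) ⊗ f) (suc n) ≡ (mono a ⊗ f) n
mono-suc-⊗ a f n =
  trans (⊗-suc (mono (suc a)) f n) (sumTo-cong n (λ i _ → cong (_* f (n ∸ i)) (mono-suc a i)))

mono-⊗-≤ : ∀ a f {n} → a ≤ n → (mono a ⊗ f) n ≡ f (n ∸ a)
mono-⊗-≤ zero    f {n}     _         = coeff (⊗-identityˡ f) n
mono-⊗-≤ (suc a) f {suc n} (s≤s a≤n) = trans (mono-suc-⊗ a f n) (mono-⊗-≤ a f a≤n)

mono-⊗-< : ∀ a f {n} → n < a → (mono a ⊗ f) n ≡ 0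
mono-⊗-< (suc a) f {zero}  _         = refl
mono-⊗-< (suc a) f {suc n} (s≤s n<a) = trans (mono-suc-⊗ a f n) (mono-⊗-< a f n<a)

mono-+ : ∀ a b → mono a ⊗ mono b ≈ mono (a + b)
mono-+ a b = coeffwise (+-coeff a)
  where
  +-coeff : ∀ a n → (mono a ⊗ mono b) n ≡ mono (a + b) n
  +-coeff zero    n       = coeff (⊗-identityˡ (mono b)) n
  +-coeff (suc a) zero    = refl
  +-coeff (suc a) (suc n) =
    trans (mono-suc-⊗ a (mono b) n) (trans (+-coeff a n) (sym (mono-suc (a + b) n)))

geom-∣ : ∀ {k n} → k ∣ n → geom k n ≡ 1
geom-∣ {k} {n} k∣n = cong (if_then 1 else 0) (trans (isYes≗does (k ∣? n)) (dec-true (k ∣? n) k∣n))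

geom-∤ : ∀ {k n} → ¬ k ∣ n → geom k n ≡ 0
geom-∤ {k} {n} k∤n = cong (if_then 1 else 0) (trans (isYes≗does (k ∣? n)) (dec-false (k ∣? n) k∤n))

geom-∸ : ∀ {k n} → k ≤ n → geom k n ≡ geom k (n ∸ k)
geom-∸ {k} {n} k≤n = cong (if_then 1 else 0) (begin
  isYes (k ∣? n)        ≡⟨ isYes≗does (k ∣? n) ⟩
  does (k ∣? n)         ≡⟨ does-⇔ (mk⇔ to from) (k ∣? n) (k ∣? (n ∸ k)) ⟩
  does (k ∣? (n ∸ k))   ≡⟨ isYes≗does (k ∣? (n ∸ k)) ⟨
  isYes (k ∣? (n ∸ k))  ∎)
  where
  open ≡-Reasoning
  to : k ∣ n → k ∣ n ∸ k
  to k∣n = ∣m+n∣m⇒∣n (subst (k ∣_) (sym (m+[n∸m]≡n k≤n)) k∣n) ∣-refl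
  from : k ∣ n ∸ k → k ∣ n
  from k∣n∸k = subst (k ∣_) (m+[n∸m]≡n k≤n) (∣m∣n⇒∣m+n ∣-refl k∣n∸k)

-- G = 1/(1 − m).
record IsGeometric (m G : FPS) : Set where
  field unfold : G ≈ one ⊕ m ⊗ G
open IsGeometric

IsGeometric-cong : ∀ {m m′ G} → m ≈ m′ → IsGeometric m G → IsGeometric m′ G
IsGeometric-cong {G = G} m≈m′ G-geo = record
  { unfold = ≈-trans (unfold G-geo) (⊕-cong (≈-refl {one}) (⊗-cong m≈m′ (≈-refl {G}))) }

geom-isGeometric : ∀ {k} → 0 < k → IsGeometric (mono k) (geom k)
geom-isGeometric {k} 0<k = record { unfold = coeffwise unfold-coeff }
  where
  unfold-coeff : ∀ n → geom k n ≡ one n + (mono k ⊗ geom k) n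
  unfold-coeff zero = trans (geom-∣ (divides 0 refl)) (cong suc (sym (mono-⊗-< k (geom k) 0<k)))
  unfold-coeff (suc n) with k ≤? suc n
  ... | yes k≤n = trans (geom-∸ k≤n) (sym (mono-⊗-≤ k (geom k) k≤n))
  ... | no k≰n  = trans (geom-∤ (k≰n ∘ ∣⇒≤)) (sym (mono-⊗-< k (geom k) (≰⇒> k≰n)))

infix 4 _≈[<_]_
_≈[<_]_ : FPS → ℕ → FPS → Set
f ≈[< a ] g = ∀ {j} → j < a → f j ≡ g j

mono-⊗-agree : ∀ {k} → 0 < k → ∀ {f g m} → f ≈[< m ] g → (mono k ⊗ f) m ≡ (mono k ⊗ g) m
mono-⊗-agree {k} 0<k {f} {g} {m} f≈g with k ≤? m
... | yes k≤m = begin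
  (mono k ⊗ f) m  ≡⟨ mono-⊗-≤ k f k≤m ⟩
  f (m ∸ k)       ≡⟨ f≈g (∸-monoʳ-< 0<k k≤m) ⟩
  g (m ∸ k)       ≡⟨ mono-⊗-≤ k g k≤m ⟨
  (mono k ⊗ g) m  ∎
  where open ≡-Reasoning
... | no k≰m = trans (mono-⊗-< k f (≰⇒> k≰m)) (sym (mono-⊗-< k g (≰⇒> k≰m)))

fixpoint-unique : ∀ {k} → 0 < k → ∀ {A X Y} → X ≈ A ⊕ mono k ⊗ X → Y ≈ A ⊕ mono k ⊗ Y → X ≈ Y
fixpoint-unique {k} 0<k {A} {X} {Y} X≈ Y≈ = coeffwise (<-rec _ λ m rec →
  trans (coeff X≈ m) (trans (cong (A m +_) (mono-⊗-agree 0<k rec)) (sym (coeff Y≈ m))))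

-- 1/(1 − x) = (1 + x)/(1 − x²), since both sides solve X = 1 + x X.
geom-split : ∀ {k} → 0 < k → geom k ≈ geom (k + k) ⊕ mono k ⊗ geom (k + k)
geom-split {k} 0<k = fixpoint-unique 0<k (unfold (geom-isGeometric 0<k)) (begin
  g ⊕ x ⊗ g
    ≈⟨ ⊕-cong (unfold (geom-isGeometric (+-mono-< 0<k 0<k))) (≈-refl {x ⊗ g}) ⟩
  (one ⊕ mono (k + k) ⊗ g) ⊕ x ⊗ g
    ≈⟨ ⊕-cong (⊕-cong (≈-refl {one}) (⊗-cong (≈-sym (mono-+ k k)) (≈-refl {g}))) (≈-refl {x ⊗ g}) ⟩
  (one ⊕ (x ⊗ x) ⊗ g) ⊕ x ⊗ g
    ≈⟨ solve 3 (λ x g o → (o :+ (x :* x) :* g) :+ x :* g := o :+ x :* (g :+ x :* g)) ≈-refl x g one ⟩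
  one ⊕ x ⊗ (g ⊕ x ⊗ g) ∎)
  where
  open ≈-Reasoning
  g x : FPS
  g = geom (k + k)
  x = mono k

remainder-≈[<] : ∀ {a F G} H → F ≈ G ⊕ mono a ⊗ H → F ≈[< a ] G
remainder-≈[<] {a} {F} {G} H F≈ {j} j<a =
  trans (coeff F≈ j) (trans (cong (G j +_) (mono-⊗-< a H j<a)) (+-identityʳ (G j)))

≈[<]-sym : ∀ {a f g} → f ≈[< a ] g → g ≈[< a ] f
≈[<]-sym f≈g j<a = sym (f≈g j<a)

≈[<]-weaken : ∀ {a b f g} → b ≤ a → f ≈[< a ] g → f ≈[< b ] g
≈[<]-weaken b≤a f≈g j<b = f≈g (<-≤-trans j<b b≤a)

⊗-≈[<] : ∀ {n f f′ g g′} → f ≈[< suc n ] f′ → g ≈[< suc n ] g′ → (f ⊗ g) n ≡ (f′ ⊗ g′) n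
⊗-≈[<] {n} f≈f′ g≈g′ =
  sumTo-cong n (λ i i≤n → cong₂ _*_ (f≈f′ (s≤s i≤n)) (g≈g′ (s≤s (m∸n≤m n i))))

geom-⊗-unfold : ∀ {m G} → IsGeometric m G → ∀ A → G ⊗ A ≈ A ⊕ m ⊗ (G ⊗ A)
geom-⊗-unfold {m} {G} G-geo A = begin
  G ⊗ A                ≈⟨ ⊗-cong (unfold G-geo) (≈-refl {A}) ⟩
  (one ⊕ m ⊗ G) ⊗ A    ≈⟨ solve 3 (λ m G A → (con 1 :+ m :* G) :* A := A :+ m :* (G :* A)) ≈-refl m G A ⟩
  A ⊕ m ⊗ (G ⊗ A)      ∎
  where open ≈-Reasoning

telescope : ∀ {m G} → IsGeometric m G → ∀ {H H′} → H′ ≈ m ⊗ H → H ⊗ G ≈ H ⊕ H′ ⊗ G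
telescope {m} {G} G-geo {H} {H′} H′≈ = begin
  H ⊗ G              ≈⟨ ⊗-comm H G ⟩
  G ⊗ H              ≈⟨ geom-⊗-unfold G-geo H ⟩
  H ⊕ m ⊗ (G ⊗ H)    ≈⟨ solve 3 (λ m G H → H :+ m :* (G :* H) := H :+ (m :* H) :* G) ≈-refl m G H ⟩
  H ⊕ (m ⊗ H) ⊗ G    ≈⟨ ⊕-cong (≈-refl {H}) (⊗-cong (≈-sym H′≈) (≈-refl {G})) ⟩
  H ⊕ H′ ⊗ G         ∎
  where open ≈-Reasoning

q q² : FPS
q  = mono 1
q² = q ⊗ q

mono-^ : ∀ n → mono n ≈ q ^ n
mono-^ zero    = ≈-refl
mono-^ (suc n) = ≈-trans (≈-sym (mono-+ 1 n)) (⊗-cong (≈-refl {q}) (mono-^ n))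

mono-2* : ∀ a → mono (2 * a) ≈ q² ^ a
mono-2* zero    = ≈-refl
mono-2* (suc a) = begin
  mono (2 * suc a)        ≈⟨ coeffwise (λ n → cong (λ i → mono i n) (*-suc 2 a)) ⟩
  mono (2 + 2 * a)        ≈⟨ mono-+ 2 (2 * a) ⟨
  mono 2 ⊗ mono (2 * a)   ≈⟨ ⊗-cong (≈-sym (mono-+ 1 1)) (mono-2* a) ⟩
  q² ⊗ q² ^ a             ∎
  where open ≈-Reasoning

odd : ℕ → ℕ
odd zero    = 1
odd (suc N) = suc (suc (odd N))

oddPower : ℕ → FPS
oddPower zero    = q
oddPower (suc N) = q² ⊗ oddPower N

oddPower≈mono : ∀ N → oddPower N ≈ mono (odd N)
oddPower≈mono zero    = ≈-refl
oddPower≈mono (suc N) =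
  ≈-trans (⊗-cong (mono-+ 1 1) (oddPower≈mono N)) (mono-+ 2 (odd N))

0<odd : ∀ N → 0 < odd N
0<odd zero    = s≤s z≤n
0<odd (suc N) = s≤s z≤n

n<odd : ∀ n → n < odd n
n<odd zero    = s≤s z≤n
n<odd (suc n) = s≤s (≤-trans (n<odd n) (n≤1+n _))

odd-mono : ∀ d N → odd N ≤ odd (d + N)
odd-mono zero    N = ≤-refl
odd-mono (suc d) N = ≤-trans (odd-mono d N) (m≤n+m (odd (d + N)) 2)

odd≡2*+1 : ∀ N → odd N ≡ 2 * N + 1
odd≡2*+1 zero    = refl
odd≡2*+1 (suc N) = trans (cong (suc ∘ suc) (odd≡2*+1 N)) (cong (_+ 1) (sym (*-suc 2 N)))

odd-% : ∀ N → odd N % 2 ≡ 1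
odd-% zero    = refl
odd-% (suc N) = odd-% N

odd-<-odd : ∀ N {p} → p % 2 ≡ 1 → p < odd N → 2 + p ≤ odd N
odd-<-odd zero    {zero}          ()  _
odd-<-odd zero    {suc p}         _   (s≤s ())
odd-<-odd (suc N) {zero}          ()  _
odd-<-odd (suc N) {suc zero}      _   _                 = s≤s (s≤s (0<odd N))
odd-<-odd (suc N) {suc (suc p)}   p%2 (s≤s (s≤s p<odd)) = s≤s (s≤s (odd-<-odd N p%2 p<odd))

-- Cells of hook length 2

count : ℕ → (ℕ → ℕ) → List ℕ → ℕ
count h F js = length (filter (λ j → F j ≟ h) js)

count-++ : ∀ h F xs ys → count h F (xs ++ ys) ≡ count h F xs + count h F ys
count-++ h F xs ys = trans (cong length (filter-++ (λ j → F j ≟ h) xs ys)) (length-++ (filter (λ j → F j ≟ h) xs))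

count-cong : ∀ {h F G xs} → All (λ j → F j ≡ G j) xs → count h F xs ≡ count h G xs
count-cong []                        = refl
count-cong {h} {F} {G} {x ∷ xs} (Fx≡Gx ∷ eqs) with F x ≟ h
... | yes Fx≡h = trans (cong length (filter-accept (λ j → F j ≟ h) Fx≡h))
                 (trans (cong suc (count-cong eqs))
                        (sym (cong length (filter-accept (λ j → G j ≟ h) (trans (sym Fx≡Gx) Fx≡h)))))
... | no Fx≢h  = trans (cong length (filter-reject (λ j → F j ≟ h) Fx≢h))
                 (trans (count-cong eqs)
                        (sym (cong length (filter-reject (λ j → G j ≟ h) (Fx≢h ∘ trans Fx≡Gx)))))

count-none : ∀ {h} F {xs} → All (λ j → F j ≢ h) xs → count h F xs ≡ 0
count-none {h} F none = cong length (filter-none (λ j → F j ≟ h) none)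

count-yes : ∀ {h} F {j} → F j ≡ h → count h F [ j ] ≡ 1
count-yes {h} F Fj≡h = cong length (filter-accept (λ j → F j ≟ h) Fj≡h)

count-no : ∀ {h} F {j} → F j ≢ h → count h F [ j ] ≡ 0
count-no {h} F Fj≢h = cong length (filter-reject (λ j → F j ≟ h) Fj≢h)

rowHookCount : ℕ → List ℕ → ℕ → ℕ
rowHookCount h λs i = count h (hook λs i) (map suc (upTo (row λs i)))

col-∷-≤ : ∀ {j p} ν → j ≤ p → col (p ∷ ν) j ≡ suc (col ν j)
col-∷-≤ {j} ν j≤p = cong length (filter-accept (λ p → j ≤? p) j≤p)

col-∷-> : ∀ {j p} ν → p < j → col (p ∷ ν) j ≡ col ν j
col-∷-> {j} ν p<j = cong length (filter-reject (λ p → j ≤? p) (<⇒≱ p<j))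

col-replicate-++ : ∀ {j k} r μ → j ≤ k → col (replicate r k ++ μ) j ≡ r + col μ j
col-replicate-++ zero    μ j≤k = refl
col-replicate-++ (suc r) μ j≤k = trans (col-∷-≤ (replicate r _ ++ μ) j≤k) (cong suc (col-replicate-++ r μ j≤k))

col-beyond : ∀ {j μ} → All (_< j) μ → col μ j ≡ 0
col-beyond []               = refl
col-beyond (p<j ∷ μ<j) = trans (col-∷-> _ p<j) (col-beyond μ<j)

row-≤ : ∀ {p ν} i → All (_≤ p) ν → row ν i ≤ p
row-≤ i             []          = z≤n
row-≤ zero          (_ ∷ _)     = z≤n
row-≤ (suc zero)    (q≤p ∷ _)   = q≤p
row-≤ (suc (suc i)) (_ ∷ ν≤p)   = row-≤ (suc i) ν≤p

hook-∷ : ∀ {p ν} i {j} → j ≤ p → hook (p ∷ ν) (suc (suc i)) j ≡ hook ν (suc i) j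
hook-∷ {p} {ν} i {j} j≤p = begin
  row ν (suc i) + col (p ∷ ν) j + 1 ∸ (suc (suc i) + j)
    ≡⟨ cong (λ c → row ν (suc i) + c + 1 ∸ (suc (suc i) + j)) (col-∷-≤ ν j≤p) ⟩
  row ν (suc i) + suc (col ν j) + 1 ∸ (suc (suc i) + j)
    ≡⟨ cong (λ s → s + 1 ∸ (suc (suc i) + j)) (+-suc (row ν (suc i)) (col ν j)) ⟩
  row ν (suc i) + col ν j + 1 ∸ (suc i + j) ∎
  where open ≡-Reasoning

hook-first-row : ∀ {k} ν j → j ≤ k → hook (k ∷ ν) 1 j ≡ k ∸ j + col ν j + 1
hook-first-row {k} ν j j≤k = begin
  k + col (k ∷ ν) j + 1 ∸ (1 + j)  ≡⟨ cong (λ c → k + c + 1 ∸ (1 + j)) (col-∷-≤ ν j≤k) ⟩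
  k + suc (col ν j) + 1 ∸ (1 + j)  ≡⟨ cong (λ s → s + 1 ∸ (1 + j)) (+-suc k (col ν j)) ⟩
  k + col ν j + 1 ∸ j              ≡⟨ cong (_∸ j) (+-assoc k (col ν j) 1) ⟩
  k + (col ν j + 1) ∸ j            ≡⟨ +-∸-comm (col ν j + 1) j≤k ⟩
  k ∸ j + (col ν j + 1)            ≡⟨ +-assoc (k ∸ j) (col ν j) 1 ⟨
  k ∸ j + col ν j + 1              ∎
  where open ≡-Reasoning

rowHookCount-∷ : ∀ {h p ν} → All (_≤ p) ν → ∀ i →
  rowHookCount h (p ∷ ν) (suc (suc i)) ≡ rowHookCount h ν (suc i)
rowHookCount-∷ {h} {p} {ν} ν≤p i = count-cong (subst (All _) (sym (map-upTo suc (row ν (suc i))))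
  (applyUpTo⁺₁ suc (row ν (suc i)) (λ j<row → hook-∷ {ν = ν} i (≤-trans j<row (row-≤ (suc i) ν≤p)))))

cellsWithHook-∷ : ∀ {h p ν} → All (_≤ p) ν →
  cellsWithHook h (p ∷ ν) ≡ rowHookCount h (p ∷ ν) 1 + cellsWithHook h ν
cellsWithHook-∷ {h} {p} {ν} ν≤p = cong (R′ 1 +_) (cong sum (begin
  map R′ (map suc (applyUpTo suc L))   ≡⟨ cong (map R′ ∘ map suc) (map-upTo suc L) ⟨
  map R′ (map suc (map suc (upTo L)))  ≡⟨ map-∘ (map suc (upTo L)) ⟨
  map (R′ ∘ suc) (map suc (upTo L))    ≡⟨ map-∘ (upTo L) ⟨
  map (R′ ∘ suc ∘ suc) (upTo L)        ≡⟨ map-cong (rowHookCount-∷ ν≤p) (upTo L) ⟩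
  map (R ∘ suc) (upTo L)               ≡⟨ map-∘ (upTo L) ⟩
  map R (map suc (upTo L))             ∎))
  where
  open ≡-Reasoning
  R R′ : ℕ → ℕ
  R  = rowHookCount h ν
  R′ = rowHookCount h (p ∷ ν)
  L : ℕ
  L = length ν

wide : ℕ → ℕ
wide zero          = 0
wide (suc zero)    = 0
wide (suc (suc _)) = 1

-- Hook-2 cells in the top row of a block of r + 1 rows of length k, for b = wide k: the cell in
-- column k − 1 if r = 0, the cell in column k if r = 1.
newHooks : ℕ → ℕ → ℕ
newHooks b zero          = b
newHooks b (suc zero)    = 1
newHooks b (suc (suc r)) = 0

blockHooks : ℕ → ℕ → ℕ
blockHooks b zero          = 0
blockHooks b (suc zero)    = b
blockHooks b (suc (suc m)) = suc b

blockHooks-suc : ∀ b m → blockHooks b (suc m) ≡ newHooks b m + blockHooks b m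
blockHooks-suc b zero          = sym (+-identityʳ b)
blockHooks-suc b (suc zero)    = refl
blockHooks-suc b (suc (suc m)) = refl

count-hook-[r+1] : ∀ F j r → F j ≡ r + 1 → count 2 F [ j ] ≡ newHooks 0 r
count-hook-[r+1] F j zero          Fj≡1   = count-no F (λ Fj≡2 → 1+n≢n (trans (sym Fj≡2) Fj≡1))
count-hook-[r+1] F j (suc zero)    Fj≡2   = count-yes F Fj≡2
count-hook-[r+1] F j (suc (suc r)) Fj≡r+3 =
  count-no F (λ Fj≡2 → 0≢1+n (trans (suc-injective (suc-injective (trans (sym Fj≡2) Fj≡r+3))) (+-comm r 1)))

col-block : ∀ r {k j μ} → All (λ x → 2 + x ≤ k) μ → k ≤ suc j → j ≤ k → col (replicate r k ++ μ) j ≡ r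
col-block r {μ = μ} μ≤k-2 k≤j+1 j≤k = begin
  col (replicate r _ ++ μ) _  ≡⟨ col-replicate-++ r μ j≤k ⟩
  r + col μ _                 ≡⟨ cong (r +_) (col-beyond (All.map (λ 2+x≤k → ≤-pred (≤-trans 2+x≤k k≤j+1)) μ≤k-2)) ⟩
  r + 0                       ≡⟨ +-identityʳ r ⟩
  r                           ∎
  where open ≡-Reasoning

first-row-long-hooks : ∀ {k i} ν → i < k → 3 ≤ hook (2 + k ∷ ν) 1 (suc i)
first-row-long-hooks {k} {i} ν i<k = subst (3 ≤_) (sym (hook-first-row ν (suc i) i<k+2))
  (+-monoˡ-≤ 1 (≤-trans arm≥2 (m≤m+n (suc k ∸ i) (col ν (suc i)))))
  where
  i<k+2 : suc i ≤ 2 + k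
  i<k+2 = ≤-trans i<k (≤-trans (n≤1+n k) (n≤1+n (suc k)))
  arm≥2 : 2 ≤ suc k ∸ i
  arm≥2 = ≤-trans (≤-reflexive (sym (m+n∸n≡m 2 i))) (∸-monoˡ-≤ i (s≤s i<k))

cells-last-two : ∀ k → map suc (upTo (2 + k)) ≡ (applyUpTo suc k ++ [ suc k ]) ++ [ 2 + k ]
cells-last-two k =
  trans (map-upTo suc (2 + k)) (sym (trans (cong (_++ [ 2 + k ]) (applyUpTo-∷ʳ suc k)) (applyUpTo-∷ʳ suc (suc k))))

firstRowHooks : ∀ {k} → 1 ≤ k → ∀ r {μ} → All (λ x → 2 + x ≤ k) μ →
  rowHookCount 2 (k ∷ replicate r k ++ μ) 1 ≡ newHooks (wide k) r
firstRowHooks {suc zero} _ r {[]} [] =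
  count-hook-[r+1] (hook (1 ∷ ν) 1) 1 r (trans (hook-first-row ν 1 ≤-refl) (cong (_+ 1) (col-block r [] (n≤1+n 1) ≤-refl)))
  where
  ν : List ℕ
  ν = replicate r 1 ++ []
firstRowHooks {suc zero} _ r (s≤s () ∷ _)
firstRowHooks {suc (suc k)} _ r {μ} μ≤k-2 = begin
  count 2 F (map suc (upTo (2 + k)))
    ≡⟨ cong (count 2 F) (cells-last-two k) ⟩
  count 2 F ((applyUpTo suc k ++ [ suc k ]) ++ [ 2 + k ])
    ≡⟨ count-++ 2 F (applyUpTo suc k ++ [ suc k ]) [ 2 + k ] ⟩
  count 2 F (applyUpTo suc k ++ [ suc k ]) + count 2 F [ 2 + k ]
    ≡⟨ cong (_+ count 2 F [ 2 + k ]) (count-++ 2 F (applyUpTo suc k) [ suc k ]) ⟩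
  count 2 F (applyUpTo suc k) + count 2 F [ suc k ] + count 2 F [ 2 + k ]
    ≡⟨ cong₂ (λ a b → a + b + count 2 F [ 2 + k ])
             (count-none F (applyUpTo⁺₁ suc k long-hooks)) (count-hook-[r+1] F (suc k) (suc r) hook-at-k+1) ⟩
  newHooks 0 (suc r) + count 2 F [ 2 + k ]
    ≡⟨ cong (newHooks 0 (suc r) +_) (count-hook-[r+1] F (2 + k) r hook-at-k+2) ⟩
  newHooks 0 (suc r) + newHooks 0 r
    ≡⟨ last-two r ⟩
  newHooks 1 r ∎
  where
  open ≡-Reasoning
  ν : List ℕ
  ν = replicate r (2 + k) ++ μ
  F : ℕ → ℕ
  F = hook (2 + k ∷ ν) 1
  hook-at-k+1 : F (suc k) ≡ suc r + 1
  hook-at-k+1 = trans (hook-first-row ν (suc k) (n≤1+n _))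
                      (cong₂ (λ a c → a + c + 1) (m+n∸n≡m 1 (suc k)) (col-block r μ≤k-2 ≤-refl (n≤1+n _)))
  hook-at-k+2 : F (2 + k) ≡ r + 1
  hook-at-k+2 = trans (hook-first-row ν (2 + k) ≤-refl)
                      (cong₂ (λ a c → a + c + 1) (n∸n≡0 (2 + k)) (col-block r μ≤k-2 (n≤1+n _) ≤-refl))
  long-hooks : ∀ {i} → i < k → F (suc i) ≢ 2
  long-hooks i<k Fi≡2 = <⇒≱ (n<1+n 2) (subst (3 ≤_) Fi≡2 (first-row-long-hooks ν i<k))
  last-two : ∀ r → newHooks 0 (suc r) + newHooks 0 r ≡ newHooks 1 r
  last-two zero          = refl
  last-two (suc zero)    = refl
  last-two (suc (suc r)) = refl

cellsWithHook-block : ∀ {k} → 1 ≤ k → ∀ m {μ} → All (λ x → 2 + x ≤ k) μ →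
  cellsWithHook 2 (replicate m k ++ μ) ≡ blockHooks (wide k) m + cellsWithHook 2 μ
cellsWithHook-block         _   zero    _      = refl
cellsWithHook-block {k} 1≤k (suc m) {μ} μ≤k-2 = begin
  cellsWithHook 2 (k ∷ replicate m k ++ μ)
    ≡⟨ cellsWithHook-∷ (++⁺ (replicate⁺ m ≤-refl) (All.map (λ 2+x≤k → m+n≤o⇒n≤o 2 2+x≤k) μ≤k-2)) ⟩
  rowHookCount 2 (k ∷ replicate m k ++ μ) 1 + cellsWithHook 2 (replicate m k ++ μ)
    ≡⟨ cong₂ _+_ (firstRowHooks 1≤k m μ≤k-2) (cellsWithHook-block 1≤k m μ≤k-2) ⟩
  newHooks (wide k) m + (blockHooks (wide k) m + cellsWithHook 2 μ)
    ≡⟨ +-assoc (newHooks (wide k) m) _ _ ⟨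
  newHooks (wide k) m + blockHooks (wide k) m + cellsWithHook 2 μ
    ≡⟨ cong (_+ cellsWithHook 2 μ) (blockHooks-suc (wide k) m) ⟨
  blockHooks (wide k) (suc m) + cellsWithHook 2 μ ∎
  where open ≡-Reasoning

-- Enumerating odd partitions

-- The fuel only has to exceed r, as each step removes k ≥ 1 from r.
withBlocks : (ℕ → List (List ℕ)) → ℕ → ℕ → ℕ → ℕ → List (List ℕ)
withBlocks E k j r zero       = []
withBlocks E k j r (suc fuel) with k ≤? r
... | yes _ = map (replicate j k ++_) (E r) ++ withBlocks E k (suc j) (r ∸ k) fuel
... | no _  = map (replicate j k ++_) (E r)

replicate-suc-++ : ∀ {A : Set} j (k : A) xs → replicate (suc j) k ++ xs ≡ replicate j k ++ k ∷ xs
replicate-suc-++ zero    k xs = refl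
replicate-suc-++ (suc j) k xs = cong (k ∷_) (replicate-suc-++ j k xs)

module _ {E : ℕ → List (List ℕ)} {k : ℕ} where

  ∈-withBlocks⁻ : ∀ j r f {x} → x ∈ withBlocks E k j r f →
    Σ ℕ λ i → Σ ℕ λ s → Σ (List ℕ) λ μ →
      x ≡ replicate j k ++ replicate i k ++ μ × μ ∈ E s × i * k + s ≡ r
  ∈-withBlocks⁻ j r (suc f) x∈ with k ≤? r
  ∈-withBlocks⁻ j r (suc f) x∈ | no _ with ∈-map⁻ (replicate j k ++_) x∈
  ... | μ , μ∈ , refl = 0 , r , μ , refl , μ∈ , refl
  ∈-withBlocks⁻ j r (suc f) x∈ | yes k≤r with ∈-++⁻ (map (replicate j k ++_) (E r)) x∈
  ... | inj₁ x∈head with ∈-map⁻ (replicate j k ++_) x∈head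
  ...   | μ , μ∈ , refl = 0 , r , μ , refl , μ∈ , refl
  ∈-withBlocks⁻ j r (suc f) x∈ | yes k≤r | inj₂ x∈tail with ∈-withBlocks⁻ (suc j) (r ∸ k) f x∈tail
  ...   | i , s , μ , refl , μ∈ , i*k+s≡r∸k =
    suc i , s , μ , replicate-suc-++ j k (replicate i k ++ μ) , μ∈ ,
    trans (+-assoc k (i * k) s) (trans (cong (k +_) i*k+s≡r∸k) (m+[n∸m]≡n k≤r))

  ∈-withBlocks⁺ : 0 < k → ∀ j i {s μ f} → μ ∈ E s → i * k + s < f →
    replicate j k ++ replicate i k ++ μ ∈ withBlocks E k j (i * k + s) f
  ∈-withBlocks⁺ 0<k j zero {s} {f = suc f} μ∈ _ with k ≤? s
  ... | yes _ = ∈-++⁺ˡ (∈-map⁺ (replicate j k ++_) μ∈)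
  ... | no _  = ∈-map⁺ (replicate j k ++_) μ∈
  ∈-withBlocks⁺ 0<k j (suc i) {s} {μ} {suc f} μ∈ (s≤s bound) with k ≤? suc i * k + s
  ... | no k≰ = contradiction (≤-trans (m≤m+n k (i * k)) (m≤m+n (k + i * k) s)) k≰
  ... | yes _ = ∈-++⁺ʳ (map (replicate j k ++_) (E (suc i * k + s)))
      (subst₂ (λ x r → x ∈ withBlocks E k (suc j) r f) (replicate-suc-++ j k (replicate i k ++ μ)) (sym remainder)
        (∈-withBlocks⁺ 0<k (suc j) i μ∈ (<-≤-trans (+-monoˡ-< s (m<n+m (i * k) 0<k)) bound)))
    where
    remainder : suc i * k + s ∸ k ≡ i * k + s
    remainder = trans (cong (_∸ k) (+-assoc k (i * k) s)) (m+n∸m≡n k (i * k + s))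

  withBlocks-unique : (∀ s → Unique (E s)) → (∀ {s μ} → μ ∈ E s → All (_< k) μ) →
    ∀ j r f → Unique (withBlocks E k j r f)
  withBlocks-unique unique below j r zero = []
  withBlocks-unique unique below j r (suc f) with k ≤? r
  ... | no _  = Unique.map⁺ (++-cancelˡ (replicate j k) _ _) (unique r)
  ... | yes _ = Unique.++⁺ (Unique.map⁺ (++-cancelˡ (replicate j k) _ _) (unique r))
                           (withBlocks-unique unique below (suc j) (r ∸ k) f) disjoint
    where
    disjoint : ∀ {v} → ¬ (v ∈ map (replicate j k ++_) (E r) × v ∈ withBlocks E k (suc j) (r ∸ k) f)
    disjoint (v∈head , v∈tail) with ∈-map⁻ (replicate j k ++_) v∈head | ∈-withBlocks⁻ (suc j) (r ∸ k) f v∈tail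
    ... | μ , μ∈ , refl | i , s , ν , eq , _ , _ with below μ∈
    ...   | μ<k with ++-cancelˡ (replicate j k) μ _ (trans eq (replicate-suc-++ j k (replicate i k ++ ν)))
    ...     | refl with μ<k
    ...       | k<k ∷ _ = <-irrefl refl k<k

oddPartitions : ℕ → ℕ → List (List ℕ)
oddPartitions zero    zero    = [ [] ]
oddPartitions zero    (suc n) = []
oddPartitions (suc N) n       = withBlocks (oddPartitions N) (odd N) 0 n (suc n)

OddPartitionBelow : ℕ → ℕ → List ℕ → Set
OddPartitionBelow N n μ = IsOddPartition n μ × All (_< odd N) μ

sum-replicate : ∀ i k → sum (replicate i k) ≡ i * k
sum-replicate zero    k = refl
sum-replicate (suc i) k = cong (k +_) (sum-replicate i k)

Linked-replicate-++ : ∀ m {k μ} → All (_≤ k) μ → Linked _≥_ μ → Linked _≥_ (replicate m k ++ μ)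
Linked-replicate-++ zero                     _           Lμ = Lμ
Linked-replicate-++ (suc zero)    {μ = []}    _           _  = [-]
Linked-replicate-++ (suc zero)    {μ = _ ∷ _} (y≤k ∷ _)   Lμ = y≤k ∷ Lμ
Linked-replicate-++ (suc (suc m))            μ≤k         Lμ = ≤-refl ∷ Linked-replicate-++ (suc m) μ≤k Lμ

replicate-++-below : ∀ {N s μ} i → OddPartitionBelow N s μ →
  OddPartitionBelow (suc N) (i * odd N + s) (replicate i (odd N) ++ μ)
replicate-++-below {N} {s} {μ} i (((Lμ , μ>0 , Σμ) , μ-odd) , μ<k) =
  ((Linked-replicate-++ i (All.map <⇒≤ μ<k) Lμ , ++⁺ (replicate⁺ i (0<odd N)) μ>0 , sum-eq) ,
   ++⁺ (replicate⁺ i (odd-% N)) μ-odd) ,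
  ++⁺ (replicate⁺ i k<k+2) (All.map (λ p<k → <-trans p<k k<k+2) μ<k)
  where
  k<k+2 : odd N < odd (suc N)
  k<k+2 = ≤-trans (n<1+n (odd N)) (n≤1+n _)
  sum-eq : sum (replicate i (odd N) ++ μ) ≡ i * odd N + s
  sum-eq = trans (sum-++ (replicate i (odd N)) μ) (cong₂ _+_ (sum-replicate i (odd N)) Σμ)

oddPartitions-sound : ∀ N {r μ} → μ ∈ oddPartitions N r → OddPartitionBelow N r μ
oddPartitions-sound zero    {zero} (here refl) = (([] , [] , refl) , []) , []
oddPartitions-sound (suc N) {r}    μ∈ with ∈-withBlocks⁻ {E = oddPartitions N} {k = odd N} 0 r (suc r) μ∈
... | i , s , ν , refl , ν∈ , refl = replicate-++-below i (oddPartitions-sound N ν∈)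

oddPartitions-unique : ∀ N r → Unique (oddPartitions N r)
oddPartitions-unique zero    zero    = [] ∷ []
oddPartitions-unique zero    (suc r) = []
oddPartitions-unique (suc N) r       =
  withBlocks-unique (oddPartitions-unique N) (λ μ∈ → proj₂ (oddPartitions-sound N μ∈)) 0 r (suc r)

Linked-≥⇒All-≤ : ∀ {p μ} → Linked _≥_ (p ∷ μ) → All (_≤ p) μ
Linked-≥⇒All-≤ [-]          = []
Linked-≥⇒All-≤ (q≤p ∷ Lqμ) = q≤p ∷ All.map (λ x≤q → ≤-trans x≤q q≤p) (Linked-≥⇒All-≤ Lqμ)

split-leading : ∀ k {μ} → Linked _≥_ μ → All (_≤ k) μ →
  Σ ℕ λ i → Σ (List ℕ) λ ν → μ ≡ replicate i k ++ ν × All (_< k) ν × Linked _≥_ ν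
split-leading k {[]}    _  _           = 0 , [] , refl , [] , []
split-leading k {p ∷ μ} Lμ (p≤k ∷ μ≤k) with p ≟ k
... | yes refl with split-leading k (Linked.tail Lμ) μ≤k
...   | i , ν , refl , ν<k , Lν = suc i , ν , refl , ν<k , Lν
split-leading k {p ∷ μ} Lμ (p≤k ∷ μ≤k) | no p≢k =
  0 , p ∷ μ , refl , p<k ∷ All.map (λ q≤p → ≤-<-trans q≤p p<k) (Linked-≥⇒All-≤ Lμ) , Lμ
  where
  p<k : p < k
  p<k = ≤∧≢⇒< p≤k p≢k

oddPartitions-complete : ∀ N {r μ} → OddPartitionBelow N r μ → μ ∈ oddPartitions N r
oddPartitions-complete zero {μ = []}        (((_ , _ , refl) , _) , _) = here refl
oddPartitions-complete zero {μ = zero ∷ _}  ((_ , () ∷ _) , _)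
oddPartitions-complete zero {μ = suc _ ∷ _} (_ , s≤s () ∷ _)
oddPartitions-complete (suc N) {μ = μ} (((Lμ , μ>0 , refl) , μ-odd) , μ<k+2)
  with split-leading (odd N) Lμ
         (All.zipWith (λ (p-odd , p<k+2) → ≤-pred (≤-pred (odd-<-odd (suc N) p-odd p<k+2))) (μ-odd , μ<k+2))
... | i , ν , refl , ν<k , Lν =
  subst (λ r → replicate i k ++ ν ∈ withBlocks (oddPartitions N) k 0 r (suc r)) (sym sum-eq)
    (∈-withBlocks⁺ (0<odd N) 0 i ν∈ ≤-refl)
  where
  k : ℕ
  k = odd N
  ν∈ : ν ∈ oddPartitions N (sum ν)
  ν∈ = oddPartitions-complete N (((Lν , ++⁻ʳ (replicate i k) μ>0 , refl) , ++⁻ʳ (replicate i k) μ-odd) , ν<k)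
  sum-eq : sum (replicate i k ++ ν) ≡ i * k + sum ν
  sum-eq = trans (sum-++ (replicate i k) ν) (cong (_+ sum ν) (sum-replicate i k))

parts-≤-sum : ∀ μ → All (_≤ sum μ) μ
parts-≤-sum []      = []
parts-≤-sum (p ∷ μ) = m≤m+n p (sum μ) ∷ All.map (λ x≤Σμ → ≤-trans x≤Σμ (m≤n+m (sum μ) p)) (parts-≤-sum μ)

∈-oddPartitions : ∀ n μ → μ ∈ oddPartitions (suc n) n ⇔ IsOddPartition n μ
∈-oddPartitions n μ = mk⇔ (proj₁ ∘ oddPartitions-sound (suc n)) λ μ-odd@((_ , _ , Σμ≡n) , _) →
  oddPartitions-complete (suc n) (μ-odd , All.map (λ p≤Σμ → ≤-<-trans (subst (_ ≤_) Σμ≡n p≤Σμ) n<odd[1+n]) (parts-≤-sum μ))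
  where
  n<odd[1+n] : n < odd (suc n)
  n<odd[1+n] = <-trans (n<1+n n) (n<odd (suc n))

-- Generating functions

sum-map-+ : ∀ {A : Set} (f g : A → ℕ) xs → sum (map (λ x → f x + g x) xs) ≡ sum (map f xs) + sum (map g xs)
sum-map-+ f g []       = refl
sum-map-+ f g (x ∷ xs) =
  trans (cong (f x + g x +_) (sum-map-+ f g xs)) (interchange (f x) (g x) (sum (map f xs)) (sum (map g xs)))

sum-map-*ˡ : ∀ {A : Set} c (f : A → ℕ) xs → sum (map (λ x → c * f x) xs) ≡ c * sum (map f xs)
sum-map-*ˡ c f []       = sym (*-zeroʳ c)
sum-map-*ˡ c f (x ∷ xs) = trans (cong (c * f x +_) (sum-map-*ˡ c f xs)) (sym (*-distribˡ-+ c (f x) _))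

sum-map-const : ∀ {A : Set} c (xs : List A) → sum (map (λ _ → c) xs) ≡ c * sum (map (λ _ → 1) xs)
sum-map-const c xs = trans (cong sum (map-cong (λ _ → sym (*-identityʳ c)) xs))
                           (sum-map-*ˡ c (λ _ → 1) xs)

sum-map-unique : ∀ {A : Set} (f : A → ℕ) {xs ys : List A} → Unique xs → Unique ys →
  (∀ {x} → x ∈ xs ⇔ x ∈ ys) → sum (map f xs) ≡ sum (map f ys)
sum-map-unique f xs! ys! xs≈ys = sum-↭ (↭-map⁺ f (∼bag⇒↭ (unique∧set⇒bag xs! ys! xs≈ys)))

suc-C₂ : ∀ a → suc a C 2 ≡ a + a C 2
suc-C₂ a = trans (sym (nCk+nC[k+1]≡[n+1]C[k+1] a 1)) (cong (_+ a C 2) (nC1≡n a))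

C₂-+ : ∀ a b → (a + b) C 2 ≡ a C 2 + a * b + b C 2
C₂-+ zero    b = refl
C₂-+ (suc a) b = begin
  suc (a + b) C 2                    ≡⟨ suc-C₂ (a + b) ⟩
  (a + b) + (a + b) C 2              ≡⟨ cong ((a + b) +_) (C₂-+ a b) ⟩
  (a + b) + (a C 2 + a * b + b C 2)  ≡⟨ +-assoc (a + b) (a C 2 + a * b) (b C 2) ⟨
  (a + b) + (a C 2 + a * b) + b C 2  ≡⟨ cong (_+ b C 2) (interchange a b (a C 2) (a * b)) ⟩
  (a + a C 2) + (b + a * b) + b C 2  ≡⟨ cong (λ t → t + (b + a * b) + b C 2) (suc-C₂ a) ⟨
  suc a C 2 + suc a * b + b C 2      ∎
  where open ≡-Reasoning

statSeries : (List ℕ → ℕ) → ℕ → FPS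
statSeries F N r = sum (map F (oddPartitions N r))

countSeries hookSeries hookPairSeries : ℕ → FPS
countSeries    = statSeries (λ _ → 1)
hookSeries     = statSeries (cellsWithHook 2)
hookPairSeries = statSeries (λ μ → cellsWithHook 2 μ C 2)

sum-withBlocks : ∀ (F : List ℕ → ℕ) E {k} → 0 < k → (B Y : ℕ → FPS) →
  (∀ j r → sum (map (λ μ → F (replicate j k ++ μ)) (E r)) ≡ B j r) →
  (∀ j → Y j ≈ B j ⊕ mono k ⊗ Y (suc j)) →
  ∀ j r f → r < f → sum (map F (withBlocks E k j r f)) ≡ Y j r
sum-withBlocks F E {k} 0<k B Y B≡ Y≈ j r (suc f) (s≤s r≤f) with k ≤? r
... | yes k≤r = begin
  sum (map F (head ++ rest))            ≡⟨ cong sum (map-++ F head rest) ⟩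
  sum (map F head ++ map F rest)        ≡⟨ sum-++ (map F head) (map F rest) ⟩
  sum (map F head) + sum (map F rest)   ≡⟨ cong₂ _+_ head-sum (sum-withBlocks F E 0<k B Y B≡ Y≈ (suc j) (r ∸ k) f r∸k<f) ⟩
  B j r + Y (suc j) (r ∸ k)             ≡⟨ cong (B j r +_) (mono-⊗-≤ k (Y (suc j)) k≤r) ⟨
  B j r + (mono k ⊗ Y (suc j)) r        ≡⟨ coeff (Y≈ j) r ⟨
  Y j r                                 ∎
  where
  open ≡-Reasoning
  head rest : List (List ℕ)
  head = map (replicate j k ++_) (E r)
  rest = withBlocks E k (suc j) (r ∸ k) f
  head-sum : sum (map F head) ≡ B j r
  head-sum = trans (cong sum (sym (map-∘ (E r)))) (B≡ j r)
  r∸k<f : r ∸ k < f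
  r∸k<f = ≤-trans (∸-monoʳ-< 0<k k≤r) r≤f
... | no k≰r = begin
  sum (map F (map (replicate j k ++_) (E r)))  ≡⟨ trans (cong sum (sym (map-∘ (E r)))) (B≡ j r) ⟩
  B j r                                        ≡⟨ +-identityʳ (B j r) ⟨
  B j r + 0                                    ≡⟨ cong (B j r +_) (mono-⊗-< k (Y (suc j)) (≰⇒> k≰r)) ⟨
  B j r + (mono k ⊗ Y (suc j)) r               ≡⟨ coeff (Y≈ j) r ⟨
  Y j r                                        ∎
  where open ≡-Reasoning

phases : FPS → FPS → FPS → ℕ → FPS
phases B₀ B₁ B₂ zero          = B₀
phases B₀ B₁ B₂ (suc zero)    = B₁
phases B₀ B₁ B₂ (suc (suc _)) = B₂

-- Σ_i m^i B_(j+i) for the sequence B₀, B₁, B₂, B₂, …, given G = 1/(1 − m).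
phaseSum : FPS → FPS → FPS → FPS → FPS → ℕ → FPS
phaseSum m G B₀ B₁ B₂ zero          = B₀ ⊕ m ⊗ (B₁ ⊕ m ⊗ (G ⊗ B₂))
phaseSum m G B₀ B₁ B₂ (suc zero)    = B₁ ⊕ m ⊗ (G ⊗ B₂)
phaseSum m G B₀ B₁ B₂ (suc (suc _)) = G ⊗ B₂

phaseSum-rec : ∀ {m G} → IsGeometric m G → ∀ B₀ B₁ B₂ j →
  phaseSum m G B₀ B₁ B₂ j ≈ phases B₀ B₁ B₂ j ⊕ m ⊗ phaseSum m G B₀ B₁ B₂ (suc j)
phaseSum-rec G-geo B₀ B₁ B₂ zero          = ≈-refl
phaseSum-rec G-geo B₀ B₁ B₂ (suc zero)    = ≈-refl
phaseSum-rec G-geo B₀ B₁ B₂ (suc (suc j)) = geom-⊗-unfold G-geo B₂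

phaseSum-closed : ∀ {m G} → IsGeometric m G → ∀ A B Z →
  phaseSum m G A (B ⊕ A) (Z ⊕ B ⊕ A) 0 ≈ G ⊗ A ⊕ m ⊗ (G ⊗ B) ⊕ m ⊗ m ⊗ (G ⊗ Z)
phaseSum-closed {m} {G} G-geo A B Z = begin
  A ⊕ m ⊗ ((B ⊕ A) ⊕ m ⊗ (G ⊗ ((Z ⊕ B) ⊕ A)))
    ≈⟨ solve 5 (λ m G A B Z → A :+ m :* ((B :+ A) :+ m :* (G :* ((Z :+ B) :+ A)))
                            := (A :+ m :* (A :+ m :* (G :* A))) :+ m :* (B :+ m :* (G :* B))
                                 :+ m :* m :* (G :* Z))
         ≈-refl m G A B Z ⟩
  (A ⊕ m ⊗ (A ⊕ m ⊗ (G ⊗ A))) ⊕ m ⊗ (B ⊕ m ⊗ (G ⊗ B)) ⊕ m ⊗ m ⊗ (G ⊗ Z)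
    ≈⟨ ⊕-cong (⊕-cong unfold-twice (⊗-cong (≈-refl {m}) (geom-⊗-unfold G-geo B))) (≈-refl {m ⊗ m ⊗ (G ⊗ Z)}) ⟨
  G ⊗ A ⊕ m ⊗ (G ⊗ B) ⊕ m ⊗ m ⊗ (G ⊗ Z) ∎
  where
  open ≈-Reasoning
  unfold-twice : G ⊗ A ≈ A ⊕ m ⊗ (A ⊕ m ⊗ (G ⊗ A))
  unfold-twice = ≈-trans (geom-⊗-unfold G-geo A) (⊕-cong (≈-refl {A}) (⊗-cong (≈-refl {m}) (geom-⊗-unfold G-geo A)))

·-identityˡ : ∀ f → 1 · f ≈ f
·-identityˡ f = coeffwise λ n → *-identityˡ (f n)

parts-fit : ∀ N {r μ} → μ ∈ oddPartitions N r → All (λ x → 2 + x ≤ odd N) μ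
parts-fit N μ∈ with oddPartitions-sound N μ∈
... | ((_ , μ-odd) , μ<k) = All.zipWith (λ (p-odd , p<k) → odd-<-odd N p-odd p<k) (μ-odd , μ<k)

sum-block-hooks : ∀ N j r →
  sum (map (λ μ → cellsWithHook 2 (replicate j (odd N) ++ μ)) (oddPartitions N r))
    ≡ blockHooks (wide (odd N)) j * countSeries N r + hookSeries N r
sum-block-hooks N j r = begin
  sum (map (λ μ → cellsWithHook 2 (replicate j (odd N) ++ μ)) E)
    ≡⟨ cong sum (map-cong-local (All.tabulate (λ μ∈ → cellsWithHook-block (0<odd N) j (parts-fit N μ∈)))) ⟩
  sum (map (λ μ → c + cellsWithHook 2 μ) E)
    ≡⟨ sum-map-+ (λ _ → c) (cellsWithHook 2) E ⟩
  sum (map (λ _ → c) E) + hookSeries N r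
    ≡⟨ cong (_+ hookSeries N r) (sum-map-const c E) ⟩
  c * countSeries N r + hookSeries N r ∎
  where
  open ≡-Reasoning
  E : List (List ℕ)
  c : ℕ
  E = oddPartitions N r
  c = blockHooks (wide (odd N)) j

sum-block-hookPairs : ∀ N j r →
  sum (map (λ μ → cellsWithHook 2 (replicate j (odd N) ++ μ) C 2) (oddPartitions N r))
    ≡ (blockHooks (wide (odd N)) j C 2) * countSeries N r + blockHooks (wide (odd N)) j * hookSeries N r + hookPairSeries N r
sum-block-hookPairs N j r = begin
  sum (map (λ μ → cellsWithHook 2 (replicate j (odd N) ++ μ) C 2) E)
    ≡⟨ cong sum (map-cong-local (All.tabulate (λ {μ} μ∈ →
         trans (cong (_C 2) (cellsWithHook-block (0<odd N) j (parts-fit N μ∈))) (C₂-+ c (cellsWithHook 2 μ))))) ⟩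
  sum (map (λ μ → c C 2 + c * cellsWithHook 2 μ + cellsWithHook 2 μ C 2) E)
    ≡⟨ sum-map-+ (λ μ → c C 2 + c * cellsWithHook 2 μ) (λ μ → cellsWithHook 2 μ C 2) E ⟩
  sum (map (λ μ → c C 2 + c * cellsWithHook 2 μ) E) + hookPairSeries N r
    ≡⟨ cong (_+ hookPairSeries N r) (sum-map-+ (λ _ → c C 2) (λ μ → c * cellsWithHook 2 μ) E) ⟩
  sum (map (λ _ → c C 2) E) + sum (map (λ μ → c * cellsWithHook 2 μ) E) + hookPairSeries N r
    ≡⟨ cong (_+ hookPairSeries N r) (cong₂ _+_ (sum-map-const (c C 2) E) (sum-map-*ˡ c (cellsWithHook 2) E)) ⟩
  (c C 2) * countSeries N r + c * hookSeries N r + hookPairSeries N r ∎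
  where
  open ≡-Reasoning
  E : List (List ℕ)
  c : ℕ
  E = oddPartitions N r
  c = blockHooks (wide (odd N)) j

wide-C₂ : ∀ k → wide k C 2 ≡ 0
wide-C₂ zero          = refl
wide-C₂ (suc zero)    = refl
wide-C₂ (suc (suc k)) = refl

suc-wide-C₂ : ∀ k → suc (wide k) C 2 ≡ wide k
suc-wide-C₂ zero          = refl
suc-wide-C₂ (suc zero)    = refl
suc-wide-C₂ (suc (suc k)) = refl

oddPower-isGeometric : ∀ N → IsGeometric (oddPower N) (geom (odd N))
oddPower-isGeometric N = IsGeometric-cong (≈-sym (oddPower≈mono N)) (geom-isGeometric (0<odd N))

statSeries-phases : ∀ F N B₀ B₁ B₂ →
  (∀ j r → sum (map (λ μ → F (replicate j (odd N) ++ μ)) (oddPartitions N r)) ≡ phases B₀ B₁ B₂ j r) →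
  statSeries F (suc N) ≈ phaseSum (oddPower N) (geom (odd N)) B₀ B₁ B₂ 0
statSeries-phases F N B₀ B₁ B₂ B≡ = coeffwise λ r →
  sum-withBlocks F (oddPartitions N) (0<odd N) (phases B₀ B₁ B₂) Y B≡ Y≈ 0 r (suc r) ≤-refl
  where
  Y : ℕ → FPS
  Y = phaseSum (oddPower N) (geom (odd N)) B₀ B₁ B₂
  Y≈ : ∀ j → Y j ≈ phases B₀ B₁ B₂ j ⊕ mono (odd N) ⊗ Y (suc j)
  Y≈ j = ≈-trans (phaseSum-rec (oddPower-isGeometric N) B₀ B₁ B₂ j)
                 (⊕-cong (≈-refl {phases B₀ B₁ B₂ j}) (⊗-cong (oddPower≈mono N) (≈-refl {Y (suc j)})))

countSeries-step : ∀ N → countSeries (suc N) ≈ geom (odd N) ⊗ countSeries N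
countSeries-step N = coeffwise λ r →
  sum-withBlocks (λ _ → 1) (oddPartitions N) (0<odd N) (λ _ → countSeries N) (λ _ → geom (odd N) ⊗ countSeries N)
    (λ _ _ → refl) (λ _ → geom-⊗-unfold (geom-isGeometric (0<odd N)) (countSeries N)) 0 r (suc r) ≤-refl

-- With x = oddPower N: (1 − x) Σ_m blockHooks b m x^m and (1 − x) Σ_m binom(blockHooks b m, 2) x^m,
-- where b = 0 for N = 0 and b = 1 otherwise.
hookWeight pairWeight : ℕ → FPS
hookWeight zero    = q²
hookWeight (suc N) = oddPower (suc N) ⊕ oddPower (suc N) ⊗ oddPower (suc N)
pairWeight zero    = 𝟘
pairWeight (suc N) = oddPower (suc N) ⊗ oddPower (suc N)

hookFactor pairFactor : ℕ → FPS
hookFactor zero    = 𝟘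
hookFactor (suc N) = hookFactor N ⊕ hookWeight N
pairFactor zero    = 𝟘
pairFactor (suc N) = pairFactor N ⊕ hookFactor N ⊗ hookWeight N ⊕ pairWeight N

hookWeight-closed : ∀ N A B → let G = geom (odd N) ; X = oddPower N in
  G ⊗ A ⊕ X ⊗ (G ⊗ (wide (odd N) · B)) ⊕ X ⊗ X ⊗ (G ⊗ B) ≈ G ⊗ (A ⊕ hookWeight N ⊗ B)
hookWeight-closed zero A B =
  solve 4 (λ G X A B → G :* A :+ X :* (G :* con 0) :+ X :* X :* (G :* B) := G :* (A :+ X :* X :* B))
    ≈-refl (geom 1) q A B
hookWeight-closed (suc N) A B = ≈-trans
  (⊕-cong (⊕-cong (≈-refl {G ⊗ A}) (⊗-cong (≈-refl {X}) (⊗-cong (≈-refl {G}) (·-identityˡ B))))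
          (≈-refl {X ⊗ X ⊗ (G ⊗ B)}))
  (solve 4 (λ G X A B → G :* A :+ X :* (G :* B) :+ X :* X :* (G :* B) := G :* (A :+ (X :+ X :* X) :* B))
    ≈-refl G X A B)
  where
  G X : FPS
  G = geom (odd (suc N))
  X = oddPower (suc N)

pairWeight-closed : ∀ N A B D → let G = geom (odd N) ; X = oddPower N ; b = wide (odd N) in
  G ⊗ A ⊕ X ⊗ (G ⊗ (b · B)) ⊕ X ⊗ X ⊗ (G ⊗ (b · D ⊕ B))
    ≈ G ⊗ (A ⊕ hookWeight N ⊗ B ⊕ pairWeight N ⊗ D)
pairWeight-closed zero A B D =
  solve 5 (λ G X A B D → G :* A :+ X :* (G :* con 0) :+ X :* X :* (G :* (con 0 :+ B))
                      := G :* (A :+ X :* X :* B :+ con 0 :* D))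
    ≈-refl (geom 1) q A B D
pairWeight-closed (suc N) A B D = ≈-trans
  (⊕-cong (⊕-cong (≈-refl {G ⊗ A}) (⊗-cong (≈-refl {X}) (⊗-cong (≈-refl {G}) (·-identityˡ B))))
          (⊗-cong (≈-refl {X ⊗ X}) (⊗-cong (≈-refl {G}) (⊕-cong (·-identityˡ D) (≈-refl {B})))))
  (solve 5 (λ G X A B D → G :* A :+ X :* (G :* B) :+ X :* X :* (G :* (D :+ B))
                      := G :* (A :+ (X :+ X :* X) :* B :+ X :* X :* D))
    ≈-refl G X A B D)
  where
  G X : FPS
  G = geom (odd (suc N))
  X = oddPower (suc N)

hookSeries-step : ∀ N → hookSeries (suc N) ≈ geom (odd N) ⊗ (hookSeries N ⊕ hookWeight N ⊗ countSeries N)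
hookSeries-step N = begin
  hookSeries (suc N)
    ≈⟨ statSeries-phases (cellsWithHook 2) N S₁ (b · S₀ ⊕ S₁) (S₀ ⊕ b · S₀ ⊕ S₁)
         (λ j r → trans (sum-block-hooks N j r) (phase-values j r)) ⟩
  phaseSum (oddPower N) G S₁ (b · S₀ ⊕ S₁) (S₀ ⊕ b · S₀ ⊕ S₁) 0
    ≈⟨ phaseSum-closed (oddPower-isGeometric N) S₁ (b · S₀) S₀ ⟩
  G ⊗ S₁ ⊕ oddPower N ⊗ (G ⊗ (b · S₀)) ⊕ oddPower N ⊗ oddPower N ⊗ (G ⊗ S₀)
    ≈⟨ hookWeight-closed N S₁ S₀ ⟩
  G ⊗ (S₁ ⊕ hookWeight N ⊗ S₀) ∎
  where
  open ≈-Reasoning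
  G : FPS
  G = geom (odd N)
  b : ℕ
  b = wide (odd N)
  S₀ S₁ : FPS
  S₀ = countSeries N
  S₁ = hookSeries N
  phase-values : ∀ j r →
    blockHooks b j * S₀ r + S₁ r ≡ phases S₁ (b · S₀ ⊕ S₁) (S₀ ⊕ b · S₀ ⊕ S₁) j r
  phase-values zero          r = refl
  phase-values (suc zero)    r = refl
  phase-values (suc (suc j)) r = refl

hookPairSeries-step : ∀ N → hookPairSeries (suc N) ≈
  geom (odd N) ⊗ (hookPairSeries N ⊕ hookWeight N ⊗ hookSeries N ⊕ pairWeight N ⊗ countSeries N)
hookPairSeries-step N = begin
  hookPairSeries (suc N)
    ≈⟨ statSeries-phases (λ μ → cellsWithHook 2 μ C 2) N S₂ (b · S₁ ⊕ S₂) (b · S₀ ⊕ S₁ ⊕ b · S₁ ⊕ S₂)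
         (λ j r → trans (sum-block-hookPairs N j r) (phase-values j r)) ⟩
  phaseSum (oddPower N) G S₂ (b · S₁ ⊕ S₂) (b · S₀ ⊕ S₁ ⊕ b · S₁ ⊕ S₂) 0
    ≈⟨ phaseSum-closed (oddPower-isGeometric N) S₂ (b · S₁) (b · S₀ ⊕ S₁) ⟩
  G ⊗ S₂ ⊕ oddPower N ⊗ (G ⊗ (b · S₁)) ⊕ oddPower N ⊗ oddPower N ⊗ (G ⊗ (b · S₀ ⊕ S₁))
    ≈⟨ pairWeight-closed N S₂ S₁ S₀ ⟩
  G ⊗ (S₂ ⊕ hookWeight N ⊗ S₁ ⊕ pairWeight N ⊗ S₀) ∎
  where
  open ≈-Reasoning
  G : FPS
  G = geom (odd N)
  b : ℕ
  b = wide (odd N)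
  S₀ S₁ S₂ : FPS
  S₀ = countSeries N
  S₁ = hookSeries N
  S₂ = hookPairSeries N
  phase-values : ∀ j r → (blockHooks b j C 2) * S₀ r + blockHooks b j * S₁ r + S₂ r
                       ≡ phases S₂ (b · S₁ ⊕ S₂) (b · S₀ ⊕ S₁ ⊕ b · S₁ ⊕ S₂) j r
  phase-values zero          r = refl
  phase-values (suc zero)    r = cong (λ c → c * S₀ r + b * S₁ r + S₂ r) (wide-C₂ (odd N))
  phase-values (suc (suc j)) r = cong (_+ S₂ r)
    (trans (cong (λ c → c * S₀ r + (S₁ r + b * S₁ r)) (suc-wide-C₂ (odd N))) (sym (+-assoc (b * S₀ r) (S₁ r) (b * S₁ r))))

oddProd-suc : ∀ N → oddProd (suc N) ≈ geom (odd N) ⊗ oddProd N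
oddProd-suc N = ≈-trans (⊗-comm (oddProd N) (geom (2 * N + 1)))
  (⊗-cong (coeffwise λ n → cong (λ k → geom k n) (sym (odd≡2*+1 N))) (≈-refl {oddProd N}))

countSeries≈ : ∀ N → countSeries N ≈ oddProd N
countSeries≈ zero    = coeffwise λ { zero → refl ; (suc r) → refl }
countSeries≈ (suc N) = begin
  countSeries (suc N)          ≈⟨ countSeries-step N ⟩
  geom (odd N) ⊗ countSeries N ≈⟨ ⊗-cong (≈-refl {geom (odd N)}) (countSeries≈ N) ⟩
  geom (odd N) ⊗ oddProd N     ≈⟨ oddProd-suc N ⟨
  oddProd (suc N)              ∎
  where open ≈-Reasoning

hookSeries≈ : ∀ N → hookSeries N ≈ oddProd N ⊗ hookFactor N
hookSeries≈ zero    = ≈-trans (coeffwise λ { zero → refl ; (suc r) → refl }) (≈-sym (⊗-zeroʳ one))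
hookSeries≈ (suc N) = begin
  hookSeries (suc N)
    ≈⟨ hookSeries-step N ⟩
  G ⊗ (hookSeries N ⊕ e₁ ⊗ countSeries N)
    ≈⟨ ⊗-cong (≈-refl {G}) (⊕-cong (hookSeries≈ N) (⊗-cong (≈-refl {e₁}) (countSeries≈ N))) ⟩
  G ⊗ (P ⊗ V ⊕ e₁ ⊗ P)
    ≈⟨ solve 4 (λ G P V e₁ → G :* (P :* V :+ e₁ :* P) := (G :* P) :* (V :+ e₁)) ≈-refl G P V e₁ ⟩
  (G ⊗ P) ⊗ (V ⊕ e₁)
    ≈⟨ ⊗-cong (oddProd-suc N) (≈-refl {V ⊕ e₁}) ⟨
  oddProd (suc N) ⊗ hookFactor (suc N) ∎
  where
  open ≈-Reasoning
  G P V e₁ : FPS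
  G = geom (odd N)
  P = oddProd N
  V = hookFactor N
  e₁ = hookWeight N

hookPairSeries≈ : ∀ N → hookPairSeries N ≈ oddProd N ⊗ pairFactor N
hookPairSeries≈ zero    = ≈-trans (coeffwise λ { zero → refl ; (suc r) → refl }) (≈-sym (⊗-zeroʳ one))
hookPairSeries≈ (suc N) = begin
  hookPairSeries (suc N)
    ≈⟨ hookPairSeries-step N ⟩
  G ⊗ (hookPairSeries N ⊕ e₁ ⊗ hookSeries N ⊕ e₂ ⊗ countSeries N)
    ≈⟨ ⊗-cong (≈-refl {G}) (⊕-cong (⊕-cong (hookPairSeries≈ N) (⊗-cong (≈-refl {e₁}) (hookSeries≈ N)))
                                    (⊗-cong (≈-refl {e₂}) (countSeries≈ N))) ⟩
  G ⊗ (P ⊗ W ⊕ e₁ ⊗ (P ⊗ V) ⊕ e₂ ⊗ P)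
    ≈⟨ solve 6 (λ G P V W e₁ e₂ → G :* (P :* W :+ e₁ :* (P :* V) :+ e₂ :* P)
                                 := (G :* P) :* (W :+ V :* e₁ :+ e₂))
         ≈-refl G P V W e₁ e₂ ⟩
  (G ⊗ P) ⊗ (W ⊕ V ⊗ e₁ ⊕ e₂)
    ≈⟨ ⊗-cong (oddProd-suc N) (≈-refl {W ⊕ V ⊗ e₁ ⊕ e₂}) ⟨
  oddProd (suc N) ⊗ pairFactor (suc N) ∎
  where
  open ≈-Reasoning
  G P V W e₁ e₂ : FPS
  G = geom (odd N)
  P = oddProd N
  V = hookFactor N
  W = pairFactor N
  e₁ = hookWeight N
  e₂ = pairWeight N

-- The limit of pairFactor

geom-2*-isGeometric : ∀ a → 0 < a → IsGeometric (q² ^ a) (geom (2 * a))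
geom-2*-isGeometric a 0<a = IsGeometric-cong (mono-2* a) (geom-isGeometric (*-monoʳ-< 2 0<a))

-- tailTerm a c X = Σ_{t≥0} (q^(2t) X)^a c.
tailTerm : ℕ → FPS → FPS → FPS
tailTerm a c X = X ^ a ⊗ c ⊗ geom (2 * a)

tailTerm-step : ∀ a → 0 < a → ∀ c X → tailTerm a c X ≈ X ^ a ⊗ c ⊕ tailTerm a c (q² ⊗ X)
tailTerm-step a 0<a c X = telescope (geom-2*-isGeometric a 0<a) (begin
  (q² ⊗ X) ^ a ⊗ c        ≈⟨ ⊗-cong (^-distrib-* q² X a) (≈-refl {c}) ⟩
  q² ^ a ⊗ X ^ a ⊗ c      ≈⟨ ⊗-assoc (q² ^ a) (X ^ a) c ⟩
  q² ^ a ⊗ (X ^ a ⊗ c)    ∎)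
  where open ≈-Reasoning

g₂ g₄ g₆ g₈ : FPS
g₂ = geom 2
g₄ = geom 4
g₆ = geom 6
g₈ = geom 8

-- For X = x_N (N ≥ 1), where x_t = q^(2t+1) and e_t = x_t + x_t²: linearTail X = Σ_{t≥N} e_t,
-- squareTail X = Σ_{t≥N} x_t² and crossTail X = Σ_{N≤s<t} e_s e_t.
linearTail squareTail crossTail : FPS → FPS
linearTail X = tailTerm 1 one X ⊕ tailTerm 2 one X
squareTail X = tailTerm 2 one X
crossTail  X = tailTerm 2 (q² ⊗ g₂) X ⊕ tailTerm 4 (q² ^ 2 ⊗ g₄) X
             ⊕ tailTerm 3 (q² ⊗ g₂) X ⊕ tailTerm 3 (q² ^ 2 ⊗ g₄) X

tail : FPS → FPS → FPS
tail V X = V ⊗ linearTail X ⊕ squareTail X ⊕ crossTail X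

linearTail-step : ∀ X → linearTail X ≈ (X ⊕ X ⊗ X) ⊕ linearTail (q² ⊗ X)
linearTail-step X = ≈-trans
  (⊕-cong (tailTerm-step 1 (s≤s z≤n) one X) (tailTerm-step 2 (s≤s z≤n) one X))
  (solve 3 (λ X L₁ L₂ → (X :^ 1 :* con 1 :+ L₁) :+ (X :^ 2 :* con 1 :+ L₂)
                      := (X :+ X :* X) :+ (L₁ :+ L₂))
     ≈-refl X (tailTerm 1 one (q² ⊗ X)) (tailTerm 2 one (q² ⊗ X)))

squareTail-step : ∀ X → squareTail X ≈ X ⊗ X ⊕ squareTail (q² ⊗ X)
squareTail-step X = ≈-trans (tailTerm-step 2 (s≤s z≤n) one X)
  (solve 2 (λ X S → X :^ 2 :* con 1 :+ S := X :* X :+ S) ≈-refl X (squareTail (q² ⊗ X)))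

crossTail-step : ∀ X → crossTail X ≈ (X ⊕ X ⊗ X) ⊗ linearTail (q² ⊗ X) ⊕ crossTail (q² ⊗ X)
crossTail-step X = ≈-trans
  (⊕-cong (⊕-cong (⊕-cong (tailTerm-step 2 (s≤s z≤n) (q² ⊗ g₂) X)
                          (tailTerm-step 4 (s≤s z≤n) (q² ^ 2 ⊗ g₄) X))
                  (tailTerm-step 3 (s≤s z≤n) (q² ⊗ g₂) X))
          (tailTerm-step 3 (s≤s z≤n) (q² ^ 2 ⊗ g₄) X))
  (solve 8 (λ X Q G₂ G₄ C₁ C₂ C₃ C₄ →
       (X :^ 2 :* (Q :* G₂) :+ C₁) :+ (X :^ 4 :* (Q :^ 2 :* G₄) :+ C₂)
         :+ (X :^ 3 :* (Q :* G₂) :+ C₃) :+ (X :^ 3 :* (Q :^ 2 :* G₄) :+ C₄)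
     := (X :+ X :* X) :* ((Q :* X) :^ 1 :* con 1 :* G₂ :+ (Q :* X) :^ 2 :* con 1 :* G₄)
         :+ (C₁ :+ C₂ :+ C₃ :+ C₄))
     ≈-refl X q² g₂ g₄ (tailTerm 2 (q² ⊗ g₂) (q² ⊗ X)) (tailTerm 4 (q² ^ 2 ⊗ g₄) (q² ⊗ X))
     (tailTerm 3 (q² ⊗ g₂) (q² ⊗ X)) (tailTerm 3 (q² ^ 2 ⊗ g₄) (q² ⊗ X)))

tail-step : ∀ V X → tail V X ≈ V ⊗ (X ⊕ X ⊗ X) ⊕ X ⊗ X ⊕ tail (V ⊕ (X ⊕ X ⊗ X)) (q² ⊗ X)
tail-step V X = ≈-trans
  (⊕-cong (⊕-cong (⊗-cong (≈-refl {V}) (linearTail-step X)) (squareTail-step X)) (crossTail-step X))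
  (solve 5 (λ V X L S T → let E = X :+ X :* X in
              V :* (E :+ L) :+ (X :* X :+ S) :+ (E :* L :+ T) := V :* E :+ X :* X :+ ((V :+ E) :* L :+ S :+ T))
     ≈-refl V X (linearTail (q² ⊗ X)) (squareTail (q² ⊗ X)) (crossTail (q² ⊗ X)))

-- The bracket of Defs.rhs, so that rhs is invOddPoch ⊗ pairFactorLimit by definition.
pairFactorLimit : FPS
pairFactorLimit =
    mono 5 ⊗ geom 2
  ⊕ (mono 6 ⊕ mono 8) ⊗ geom 4
  ⊕ mono 8 ⊗ geom 2 ⊗ geom 4
  ⊕ (mono 11 ⊕ mono 13 ⊕ mono 13) ⊗ geom 4 ⊗ geom 6
  ⊕ mono 16 ⊗ geom 4 ⊗ geom 8

-- The bracket's (q¹¹ + 2q¹³)/((1 − q⁴)(1 − q⁶)) is the tail's q¹¹/((1 − q²)(1 − q⁶)) + q¹³/((1 − q⁴)(1 − q⁶))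
-- because 1/(1 − q²) = (1 + q²)/(1 − q⁴).
pairFactorLimit-tail₁ : pairFactorLimit ≈ pairFactor 1 ⊕ tail (hookFactor 1) (oddPower 1)
pairFactorLimit-tail₁ = begin
  pairFactorLimit
    ≈⟨ ⊕-cong (⊕-cong (⊕-cong (⊕-cong (⊗-cong (mono-^ 5) (≈-refl {g₂}))
                                     (⊗-cong (⊕-cong (mono-^ 6) (mono-^ 8)) (≈-refl {g₄})))
                             (⊗-cong (⊗-cong (mono-^ 8) (≈-refl {g₂})) (≈-refl {g₄})))
                     (⊗-cong (⊗-cong (⊕-cong (⊕-cong (mono-^ 11) (mono-^ 13)) (mono-^ 13)) (≈-refl {g₄}))
                             (≈-refl {g₆})))
             (⊗-cong (⊗-cong (mono-^ 16) (≈-refl {g₄})) (≈-refl {g₈})) ⟩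
  q ^ 5 ⊗ g₂ ⊕ (q ^ 6 ⊕ q ^ 8) ⊗ g₄ ⊕ q ^ 8 ⊗ g₂ ⊗ g₄
    ⊕ (q ^ 11 ⊕ q ^ 13 ⊕ q ^ 13) ⊗ g₄ ⊗ g₆ ⊕ q ^ 16 ⊗ g₄ ⊗ g₈
    ≈⟨ solve 5 (λ q G₂ G₄ G₆ G₈ → let Q = q :* q ; X = Q :* q in
           q :^ 5 :* G₂ :+ (q :^ 6 :+ q :^ 8) :* G₄ :+ q :^ 8 :* G₂ :* G₄
             :+ (q :^ 11 :+ q :^ 13 :+ q :^ 13) :* G₄ :* G₆ :+ q :^ 16 :* G₄ :* G₈
         := (con 0 :+ con 0 :* Q :+ con 0)
             :+ ((con 0 :+ Q) :* (X :^ 1 :* con 1 :* G₂ :+ X :^ 2 :* con 1 :* G₄)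
                 :+ X :^ 2 :* con 1 :* G₄
                 :+ (X :^ 2 :* (Q :* G₂) :* G₄ :+ X :^ 4 :* (Q :^ 2 :* G₄) :* G₈
                     :+ X :^ 3 :* (Q :* (G₄ :+ Q :* G₄)) :* G₆ :+ X :^ 3 :* (Q :^ 2 :* G₄) :* G₆)))
         ≈-refl q g₂ g₄ g₆ g₈ ⟩
  pairFactor 1 ⊕ (hookFactor 1 ⊗ linearTail X ⊕ squareTail X ⊕ (T₁ ⊕ T₂ ⊕ T₃′ ⊕ T₄))
    ≈⟨ ⊕-cong (≈-refl {pairFactor 1}) (⊕-cong (≈-refl {hookFactor 1 ⊗ linearTail X ⊕ squareTail X})
                                              (⊕-cong (⊕-cong (≈-refl {T₁ ⊕ T₂}) T₃≈T₃′) (≈-refl {T₄}))) ⟨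
  pairFactor 1 ⊕ tail (hookFactor 1) X ∎
  where
  open ≈-Reasoning
  X T₁ T₂ T₃′ T₄ : FPS
  X   = oddPower 1
  T₁  = tailTerm 2 (q² ⊗ g₂) X
  T₂  = tailTerm 4 (q² ^ 2 ⊗ g₄) X
  T₃′ = tailTerm 3 (q² ⊗ (g₄ ⊕ q² ⊗ g₄)) X
  T₄  = tailTerm 3 (q² ^ 2 ⊗ g₄) X
  g₂-split : g₂ ≈ g₄ ⊕ q² ⊗ g₄
  g₂-split = ≈-trans (geom-split (s≤s z≤n)) (⊕-cong (≈-refl {g₄}) (⊗-cong (≈-sym (mono-+ 1 1)) (≈-refl {g₄})))
  T₃≈T₃′ : tailTerm 3 (q² ⊗ g₂) X ≈ T₃′
  T₃≈T₃′ = ⊗-cong (⊗-cong (≈-refl {X ^ 3}) (⊗-cong (≈-refl {q²}) g₂-split)) (≈-refl {g₆})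

pairFactorLimit-tail : ∀ N → pairFactorLimit ≈ pairFactor (suc N) ⊕ tail (hookFactor (suc N)) (oddPower (suc N))
pairFactorLimit-tail zero    = pairFactorLimit-tail₁
pairFactorLimit-tail (suc N) = begin
  pairFactorLimit
    ≈⟨ pairFactorLimit-tail N ⟩
  W ⊕ tail V X
    ≈⟨ ⊕-cong (≈-refl {W}) (tail-step V X) ⟩
  W ⊕ (V ⊗ E ⊕ X ⊗ X ⊕ tail (V ⊕ E) (q² ⊗ X))
    ≈⟨ solve 4 (λ W A B T → W :+ (A :+ B :+ T) := (W :+ A :+ B) :+ T)
               ≈-refl W (V ⊗ E) (X ⊗ X) (tail (V ⊕ E) (q² ⊗ X)) ⟩
  (W ⊕ V ⊗ E ⊕ X ⊗ X) ⊕ tail (V ⊕ E) (q² ⊗ X) ∎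
  where
  open ≈-Reasoning
  W V X E : FPS
  W = pairFactor (suc N)
  V = hookFactor (suc N)
  X = oddPower (suc N)
  E = X ⊕ X ⊗ X

tailQuotient : FPS → FPS → FPS
tailQuotient V X = V ⊗ (g₂ ⊕ X ⊗ g₄) ⊕ X ⊗ g₄ ⊕ X ⊗ q² ⊗ g₂ ⊗ g₄
  ⊕ X ^ 3 ⊗ q² ^ 2 ⊗ g₄ ⊗ g₈ ⊕ X ^ 2 ⊗ q² ⊗ g₂ ⊗ g₆ ⊕ X ^ 2 ⊗ q² ^ 2 ⊗ g₄ ⊗ g₆

tail-divisible : ∀ V X → tail V X ≈ X ⊗ tailQuotient V X
tail-divisible V X = solve 7 (λ V X Q G₂ G₄ G₆ G₈ →
     V :* (X :^ 1 :* con 1 :* G₂ :+ X :^ 2 :* con 1 :* G₄) :+ X :^ 2 :* con 1 :* G₄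
       :+ (X :^ 2 :* (Q :* G₂) :* G₄ :+ X :^ 4 :* (Q :^ 2 :* G₄) :* G₈
           :+ X :^ 3 :* (Q :* G₂) :* G₆ :+ X :^ 3 :* (Q :^ 2 :* G₄) :* G₆)
  := X :* (V :* (G₂ :+ X :* G₄) :+ X :* G₄ :+ X :* Q :* G₂ :* G₄
       :+ X :^ 3 :* Q :^ 2 :* G₄ :* G₈ :+ X :^ 2 :* Q :* G₂ :* G₆ :+ X :^ 2 :* Q :^ 2 :* G₄ :* G₆))
  ≈-refl V X q² g₂ g₄ g₆ g₈

pairFactor-agrees : ∀ N → pairFactorLimit ≈[< odd (suc N) ] pairFactor (suc N)
pairFactor-agrees N = remainder-≈[<] (tailQuotient V X) (begin
  pairFactorLimit
    ≈⟨ pairFactorLimit-tail N ⟩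
  W ⊕ tail V X
    ≈⟨ ⊕-cong (≈-refl {W}) (tail-divisible V X) ⟩
  W ⊕ X ⊗ tailQuotient V X
    ≈⟨ ⊕-cong (≈-refl {W}) (⊗-cong (oddPower≈mono (suc N)) (≈-refl {tailQuotient V X})) ⟩
  W ⊕ mono (odd (suc N)) ⊗ tailQuotient V X ∎)
  where
  open ≈-Reasoning
  W V X : FPS
  W = pairFactor (suc N)
  V = hookFactor (suc N)
  X = oddPower (suc N)

-- Truncations of 1/(q;q²)_∞

oddProd-stable : ∀ d N → oddProd (d + N) ≈[< odd N ] oddProd N
oddProd-stable zero    N _      = refl
oddProd-stable (suc d) N j<oddN =
  trans (remainder-≈[<] (geom (odd (d + N)) ⊗ oddProd (d + N)) (oddProd-unfold (d + N)) (<-≤-trans j<oddN (odd-mono d N)))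
        (oddProd-stable d N j<oddN)
  where
  oddProd-unfold : ∀ M → oddProd (suc M) ≈ oddProd M ⊕ mono (odd M) ⊗ (geom (odd M) ⊗ oddProd M)
  oddProd-unfold M = ≈-trans (oddProd-suc M) (geom-⊗-unfold (geom-isGeometric (0<odd M)) (oddProd M))

oddProd≈[<]invOddPoch : ∀ n → oddProd (suc n) ≈[< suc n ] invOddPoch
oddProd≈[<]invOddPoch n {j} (s≤s j≤n) = begin
  oddProd (suc n) j            ≡⟨ cong (λ M → oddProd M j) (trans (+-suc (n ∸ j) j) (cong suc (m∸n+n≡m j≤n))) ⟨
  oddProd (n ∸ j + suc j) j    ≡⟨ oddProd-stable (n ∸ j) (suc j) (<-trans (n<1+n j) (n<odd (suc j))) ⟩
  oddProd (suc j) j            ∎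
  where open ≡-Reasoning

pairFactor≈[<]limit : ∀ n → pairFactor (suc n) ≈[< suc n ] pairFactorLimit
pairFactor≈[<]limit n = ≈[<]-weaken (<⇒≤ (n<odd (suc n))) (≈[<]-sym (pairFactor-agrees n))

corollary2p7 : (n : ℕ) (L : List (List ℕ)) → Unique L →
    (∀ μ → (μ ∈ L) ⇔ IsOddPartition n μ) →
    sum (map (λ μ → cellsWithHook 2 μ C 2) L) ≡ rhs n
corollary2p7 n L L! L≈ = begin
  sum (map (λ μ → cellsWithHook 2 μ C 2) L)
    ≡⟨ sum-map-unique _ L! (oddPartitions-unique (suc n) n) (λ {μ} → ⇔-sym (∈-oddPartitions n μ) ⇔-∘ L≈ μ) ⟩
  hookPairSeries (suc n) n
    ≡⟨ coeff (hookPairSeries≈ (suc n)) n ⟩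
  (oddProd (suc n) ⊗ pairFactor (suc n)) n
    ≡⟨ ⊗-≈[<] (oddProd≈[<]invOddPoch n) (pairFactor≈[<]limit n) ⟩
  (invOddPoch ⊗ pairFactorLimit) n
    ∎
  where open ≡-Reasoning
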